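{- $\textup{D-AC}_p \simeq \textup{sD-AC}_p \simeq \textup{swD-AC}_p$.
   Context: An arithmetic circuit (AC) is a finite DAG with a single source whose sinks are labeled by real constants, $\{0,1\}$-variables $x$ or complemented variables $\overline{x}$ (value $1-x$), and whose internal nodes have exactly two successors $g_l,g_r$ labeled $+$ or $\times$; size is the number of nodes. An AC is positive if it computes a nonnegative value on every assignment. $\mathit{var}(g)$ is the set of variables $x$ with $x$ or $\overline{x}$ labeling a sink reachable from $g$. A $+$-node $g$ is smooth if $\mathit{var}(g_l)=\mathit{var}(g_r)$. A $\times$-node $g$ is decomposable if $\mathit{var}(g_l)\cap\mathit{var}(g_r)=\emptyset$, weakly decomposable if each $x\in\mathit{var}(g_l)\cap\mathit{var}(g_r)$ appears with only one polarity among sinks reachable from $g$. The AC is smooth if all $+$-nodes are, (weakly) decomposable if all $\times$-nodes are. $\textup{D-AC}_p$ = decomposable positive AC, $\textup{sD-AC}_p$ = smooth decomposable positive AC, $\textup{swD-AC}_p$ = smooth weakly decomposable positive AC. For classes $\mathcal{C}_1,\mathcal{C}_2$, $\mathcal{C}_1\le\mathcal{C}_2$ if there is a polynomial $p$ such that for every $C_2\in\mathcal{C}_2$ there is $C_1\in\mathcal{C}_1$ computing the same function with $|C_1|\le p(|C_2|)$; $\mathcal{C}_1\simeq\mathcal{C}_2$ means both $\mathcal{C}_1\le\mathcal{C}_2$ and $\mathcal{C}_2\le\mathcal{C}_1$. -}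

module Defs where

open import Level using (Level; _⊔_)
import Data.Nat as ℕ
open ℕ using (ℕ; zero; suc)
open import Data.Fin using (Fin; zero; suc)
open import Data.Bool using (Bool; true; false; if_then_else_)
open import Data.Vec using (Vec; []; _∷_; lookup)
open import Data.Product using (Σ; ∃; _×_; _,_)
open import Relation.Nullary using (¬_)
open import Relation.Binary.Core using (Rel)
open import Relation.Binary.Structures using (IsTotalOrder)
open import Relation.Binary.PropositionalEquality using (_≡_)
open import Relation.Binary.Construct.Closure.ReflexiveTransitive using (Star)
open import Algebra.Bundles using (CommutativeRing)
open import Function.Bundles using (_⇔_)

-- Ordered fields (the paper uses ℝ; we work over an arbitrary ordered
-- field, of which ℝ is an instance).

record OrderedField (c ℓ₁ ℓ₂ : Level) : Set (Level.suc (c ⊔ ℓ₁ ⊔ ℓ₂)) where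
  field
    commutativeRing : CommutativeRing c ℓ₁
  open CommutativeRing commutativeRing public
  field
    _≤_           : Rel Carrier ℓ₂
    isTotalOrder  : IsTotalOrder _≈_ _≤_
    +-mono-≤      : ∀ {x y} z → x ≤ y → (x + z) ≤ (y + z)
    *-nonneg      : ∀ {x y} → 0# ≤ x → 0# ≤ y → 0# ≤ (x * y)
    0≉1           : ¬ (0# ≈ 1#)
    inverse       : ∀ x → ¬ (x ≈ 0#) → Σ Carrier λ y → (x * y) ≈ 1#

module Circuits {c ℓ₁ ℓ₂} (F : OrderedField c ℓ₁ ℓ₂) where
  open OrderedField F using (Carrier; _≈_; _≤_; _+_; _*_; 0#; 1#)

  -- sink labels: a constant, or a literal (x , true) = x, (x , false) = x̄
  data Label (v : ℕ) : Set c where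
    const : Carrier → Label v
    lit   : Fin v → Bool → Label v

  data Op : Set where
    plus times : Op

  data Node (v k : ℕ) : Set c where
    leaf : Label v → Node v k
    gate : Op → Fin k → Fin k → Node v k

  -- a DAG given as a list of nodes in topological order: the head node
  -- may only point to nodes in the tail (hence acyclicity).
  data Circ (v : ℕ) : ℕ → Set c where
    []  : Circ v 0
    _∷_ : ∀ {k} → Node v k → Circ v k → Circ v (suc k)

  shift : ∀ {v k} → Node v k → Node v (suc k)
  shift (leaf l)       = leaf l
  shift (gate o j₁ j₂) = gate o (suc j₁) (suc j₂)

  -- node i of the circuit, with successors as indices of the whole circuit
  nodeAt : ∀ {v k} → Circ v k → Fin k → Node v k
  nodeAt (nd ∷ C) zero    = shift nd
  nodeAt (nd ∷ C) (suc i) = shift (nodeAt C i)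

  Assignment : ℕ → Set
  Assignment v = Fin v → Bool

  evalLabel : ∀ {v} → Assignment v → Label v → Carrier
  evalLabel a (const r)     = r
  evalLabel a (lit x true)  = if a x then 1# else 0#
  evalLabel a (lit x false) = if a x then 0# else 1#

  evalNode : ∀ {v k} → Assignment v → Node v k → Vec Carrier k → Carrier
  evalNode a (leaf l)          vs = evalLabel a l
  evalNode a (gate plus j₁ j₂)  vs = lookup vs j₁ + lookup vs j₂
  evalNode a (gate times j₁ j₂) vs = lookup vs j₁ * lookup vs j₂

  values : ∀ {v k} → Circ v k → Assignment v → Vec Carrier k
  values []       a = []
  values (nd ∷ C) a = evalNode a nd (values C a) ∷ values C a

  -- an arithmetic circuit: a nonempty node list; node zero is the source
  AC : ℕ → Set c
  AC v = Σ ℕ λ k → Circ v (suc k)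

  size : ∀ {v} → AC v → ℕ
  size (k , C) = suc k

  ⟦_⟧ : ∀ {v} → AC v → Assignment v → Carrier
  ⟦ (k , C) ⟧ a = lookup (values C a) zero

  data Succ {v k} (C : Circ v k) (i : Fin k) : Fin k → Set c where
    left  : ∀ {o j₁ j₂} → nodeAt C i ≡ gate o j₁ j₂ → Succ C i j₁
    right : ∀ {o j₁ j₂} → nodeAt C i ≡ gate o j₁ j₂ → Succ C i j₂

  Reach : ∀ {v k} → Circ v k → Fin k → Fin k → Set c
  Reach C = Star (Succ C)

  Occurs : ∀ {v k} → Circ v k → Fin k → Fin v → Bool → Set c
  Occurs C i x b = ∃ λ j → Reach C i j × nodeAt C j ≡ leaf (lit x b)

  InVar : ∀ {v k} → Circ v k → Fin k → Fin v → Set c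
  InVar C i x = ∃ λ b → Occurs C i x b

  -- single source: node zero is the only source, i.e. every node is
  -- reachable from it
  SingleSource : ∀ {v} → AC v → Set c
  SingleSource (k , C) = ∀ j → Reach C zero j

  Smooth : ∀ {v} → AC v → Set c
  Smooth (k , C) = ∀ i j₁ j₂ → nodeAt C i ≡ gate plus j₁ j₂ →
                   ∀ x → InVar C j₁ x ⇔ InVar C j₂ x

  Decomposable : ∀ {v} → AC v → Set c
  Decomposable (k , C) = ∀ i j₁ j₂ → nodeAt C i ≡ gate times j₁ j₂ →
                         ∀ x → ¬ (InVar C j₁ x × InVar C j₂ x)

  WeaklyDecomposable : ∀ {v} → AC v → Set c
  WeaklyDecomposable (k , C) = ∀ i j₁ j₂ → nodeAt C i ≡ gate times j₁ j₂ →
                               ∀ x → InVar C j₁ x → InVar C j₂ x →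
                               ¬ (Occurs C i x true × Occurs C i x false)

  Positive : ∀ {v} → AC v → Set ℓ₂
  Positive C = ∀ a → 0# ≤ ⟦ C ⟧ a

  Class : Set (Level.suc (c ⊔ ℓ₂))
  Class = ∀ {v} → AC v → Set (c ⊔ ℓ₂)

  D-ACp : Class
  D-ACp C = SingleSource C × Decomposable C × Positive C

  sD-ACp : Class
  sD-ACp C = SingleSource C × Smooth C × Decomposable C × Positive C

  swD-ACp : Class
  swD-ACp C = SingleSource C × Smooth C × WeaklyDecomposable C × Positive C

  -- C₁ ≤ C₂ : polynomial-size simulation; the polynomial p is taken as
  -- n ↦ a * n ^ d + a (every polynomial is bounded by one of this form)
  _≼_ : Class → Class → Set (c ⊔ ℓ₁ ⊔ ℓ₂)
  𝒞₁ ≼ 𝒞₂ = ∃ λ (a : ℕ) → ∃ λ (d : ℕ) →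
    ∀ v (C₂ : AC v) → 𝒞₂ C₂ →
      ∃ λ (C₁ : AC v) → 𝒞₁ C₁ × (∀ x → ⟦ C₁ ⟧ x ≈ ⟦ C₂ ⟧ x)
                               × size C₁ ℕ.≤ a ℕ.* size C₂ ℕ.^ d ℕ.+ a

  _≃_ : Class → Class → Set (c ⊔ ℓ₁ ⊔ ℓ₂)
  𝒞₁ ≃ 𝒞₂ = (𝒞₁ ≼ 𝒞₂) × (𝒞₂ ≼ 𝒞₁)

{-# OPTIONS --safe #-}
-- A smooth decomposable circuit is both decomposable and weakly decomposable, so two of the
-- simulations are the identity.  A decomposable circuit is smoothed by rebuilding it bottom-up and,
-- at every +-gate, multiplying each child by (x̄ + x) for every variable x of its sibling that it
-- misses: these factors equal 1, and x is fresh for the child, so the new ×-gates are decomposable.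
-- A smooth weakly decomposable circuit is made decomposable by pruning.  By smoothness, a variable
-- occurring below a node with a single polarity b contributes a factor [x = b] to the value of that
-- node on every 0/1 assignment.  So every literal is replaced by 1 and each forced literal is
-- multiplied back in exactly where its variable first occurs with both polarities (or at the
-- source).  Below a pruned node only variables of mixed polarity remain, and by weak
-- decomposability a variable below both children of a ×-gate is not mixed at that gate.  Each gate
-- receives at most 2·4·|var| new nodes, whence a quadratic size bound.
module Submission where

open import Defs
open import Level using (Level)
open import Data.Nat as ℕ using (ℕ; zero; suc; _^_; z≤n; s≤s)
import Data.Nat.Properties as ℕP
open import Data.Nat.Solver using (module +-*-Solver)
open import Data.Fin using (Fin; zero; suc)
import Data.Fin.Properties as FinP
open import Data.Bool using (Bool; true; false; if_then_else_; _∧_; _∨_; not; _xor_)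
import Data.Bool.Properties as BP
open import Data.Vec using (lookup)
open import Data.Vec.Functional using () renaming (_∷_ to _V∷_)
open import Data.List using (List; []; _∷_; length)
open import Data.Product using (Σ; _×_; _,_)
open import Data.Sum using (_⊎_; inj₁; inj₂)
open import Data.Unit using (⊤; tt)
open import Data.Empty using (⊥; ⊥-elim)
open import Relation.Nullary using (yes; no)
open import Relation.Nullary.Decidable using (⌊_⌋)
open import Relation.Binary.PropositionalEquality using (_≡_; refl; cong; cong₂; sym; trans; subst)
open import Relation.Binary.Structures using (IsTotalOrder)
open import Relation.Binary.Construct.Closure.ReflexiveTransitive using (ε; _◅_; _◅◅_; gmap)
open import Function.Bundles using (mk⇔; Equivalence)
import Relation.Binary.Reasoning.Setoid as SetoidReasoning
import Algebra.Properties.CommutativeSemigroup as CommSemigroupProperties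
open import Algebra.Bundles using (CommutativeMonoid)

BoolFun : ℕ → Set
BoolFun zero    = Bool
BoolFun (suc n) = Bool → BoolFun n

valid : ∀ n → BoolFun n → Bool
valid zero    b = b
valid (suc n) f = valid n (f true) ∧ valid n (f false)

Valid : ∀ n → BoolFun n → Set
Valid zero    b = b ≡ true
Valid (suc n) f = ∀ b → Valid n (f b)

valid-sound : ∀ n (f : BoolFun n) → valid n f ≡ true → Valid n f
valid-sound zero    f h       = h
valid-sound (suc n) f h true  = valid-sound n (f true) (BP.∧-conicalˡ _ _ h)
valid-sound (suc n) f h false = valid-sound n (f false) (BP.∧-conicalʳ _ _ h)

infix  7 _≡ᵇ_
infixr 4.5 _⇒ᵇ_

_≡ᵇ_ : Bool → Bool → Bool
true  ≡ᵇ b = b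
false ≡ᵇ b = not b

_⇒ᵇ_ : Bool → Bool → Bool
p ⇒ᵇ q = not p ∨ q

≡ᵇ⇒≡ : ∀ {p q} → (p ≡ᵇ q) ≡ true → p ≡ q
≡ᵇ⇒≡ {true}  {true}  _ = refl
≡ᵇ⇒≡ {false} {false} _ = refl

≡⇒≡ᵇ : ∀ {p q} → p ≡ q → (p ≡ᵇ q) ≡ true
≡⇒≡ᵇ {true}  refl = refl
≡⇒≡ᵇ {false} refl = refl

⇒ᵇ-mp : ∀ {p q} → (p ⇒ᵇ q) ≡ true → p ≡ true → q ≡ true
⇒ᵇ-mp h refl = h

⇒ᵇ-intro : ∀ {p q} → (p ≡ true → q ≡ true) → (p ⇒ᵇ q) ≡ true
⇒ᵇ-intro {true}  f = f refl
⇒ᵇ-intro {false} f = refl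

true⇔true⇒≡ : ∀ {p q} → (p ≡ true → q ≡ true) → (q ≡ true → p ≡ true) → p ≡ q
true⇔true⇒≡ {true}  {true}  f g = refl
true⇔true⇒≡ {true}  {false} f g = sym (f refl)
true⇔true⇒≡ {false} {true}  f g = g refl
true⇔true⇒≡ {false} {false} f g = refl

true≢false : ∀ {p} → p ≡ true → p ≡ false → ⊥
true≢false refl ()

∨-true : ∀ {p q} → p ∨ q ≡ true → p ≡ true ⊎ q ≡ true
∨-true {true}  h = inj₁ refl
∨-true {false} h = inj₂ h

∨-trueˡ : ∀ {p q} → p ≡ true → p ∨ q ≡ true
∨-trueˡ refl = refl

∨-trueʳ : ∀ {p q} → q ≡ true → p ∨ q ≡ true
∨-trueʳ {true}  h = refl
∨-trueʳ {false} h = h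

∨-interchange : ∀ a b c d → (a ∨ b) ∨ (c ∨ d) ≡ (a ∨ c) ∨ (b ∨ d)
∨-interchange = CommSemigroupProperties.interchange (CommutativeMonoid.commutativeSemigroup BP.∨-commutativeMonoid)

both-occurs : ∀ e b → (e ∧ not b) ∨ (e ∧ b) ≡ e ∧ true
both-occurs true  true  = refl
both-occurs true  false = refl
both-occurs false b     = refl

infix 7 _≡ᶠ_ _∈ᵇ_

_≡ᶠ_ : ∀ {v} → Fin v → Fin v → Bool
x ≡ᶠ y = ⌊ x FinP.≟ y ⌋

≡ᶠ-refl : ∀ {v} (x : Fin v) → x ≡ᶠ x ≡ true
≡ᶠ-refl x with x FinP.≟ x
... | yes _ = refl
... | no x≢x = ⊥-elim (x≢x refl)

≡ᶠ⇒≡ : ∀ {v} {x y : Fin v} → x ≡ᶠ y ≡ true → x ≡ y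
≡ᶠ⇒≡ {x = x} {y} h with x FinP.≟ y
... | yes x≡y = x≡y

≡ᶠ-sym : ∀ {v} (x y : Fin v) → x ≡ᶠ y ≡ y ≡ᶠ x
≡ᶠ-sym x y with x FinP.≟ y | y FinP.≟ x
... | yes _   | yes _   = refl
... | no _    | no _    = refl
... | yes x≡y | no y≢x  = ⊥-elim (y≢x (sym x≡y))
... | no x≢y  | yes y≡x = ⊥-elim (x≢y (sym y≡x))

_∈ᵇ_ : ∀ {v} → Fin v → List (Fin v) → Bool
x ∈ᵇ []       = false
x ∈ᵇ (y ∷ ys) = y ≡ᶠ x ∨ x ∈ᵇ ys

Distinct : ∀ {v} → List (Fin v) → Set
Distinct []       = ⊤
Distinct (y ∷ ys) = y ∈ᵇ ys ≡ false × Distinct ys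

dedup : ∀ {v} → List (Fin v) → List (Fin v)
dedup []       = []
dedup (y ∷ ys) = if y ∈ᵇ dedup ys then dedup ys else y ∷ dedup ys

∈ᵇ-dedup : ∀ {v} (x : Fin v) L → x ∈ᵇ dedup L ≡ x ∈ᵇ L
∈ᵇ-dedup x [] = refl
∈ᵇ-dedup x (y ∷ ys) with y ∈ᵇ dedup ys in y∈
... | false = cong (y ≡ᶠ x ∨_) (∈ᵇ-dedup x ys)
... | true with y ≡ᶠ x in y≡x
...   | false = ∈ᵇ-dedup x ys
...   | true  = subst (λ z → z ∈ᵇ dedup ys ≡ true) (≡ᶠ⇒≡ y≡x) y∈

dedup-distinct : ∀ {v} (L : List (Fin v)) → Distinct (dedup L)
dedup-distinct [] = tt
dedup-distinct (y ∷ ys) with y ∈ᵇ dedup ys in y∈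
... | true  = dedup-distinct ys
... | false = y∈ , dedup-distinct ys

length-dedup-≤ : ∀ {v} (L : List (Fin v)) → length (dedup L) ℕ.≤ length L
length-dedup-≤ [] = z≤n
length-dedup-≤ (y ∷ ys) with y ∈ᵇ dedup ys
... | true  = ℕP.m≤n⇒m≤1+n (length-dedup-≤ ys)
... | false = s≤s (length-dedup-≤ ys)

allᵇ : ∀ {v} → (Fin v → Bool) → List (Fin v) → Bool
allᵇ f []       = true
allᵇ f (y ∷ ys) = f y ∧ allᵇ f ys

allᵇ-∧ : ∀ {v} (f g : Fin v → Bool) L → allᵇ f L ∧ allᵇ g L ≡ allᵇ (λ y → f y ∧ g y) L
allᵇ-∧ f g [] = refl
allᵇ-∧ f g (y ∷ ys) with f y | g y
... | true  | true  = allᵇ-∧ f g ys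
... | true  | false = BP.∧-zeroʳ (allᵇ f ys)
... | false | _     = refl

allᵇ-cong : ∀ {v} {f g : Fin v → Bool} → (∀ y → f y ≡ g y) → ∀ L → allᵇ f L ≡ allᵇ g L
allᵇ-cong h []       = refl
allᵇ-cong h (y ∷ ys) = cong₂ _∧_ (h y) (allᵇ-cong h ys)

allᵇ-split : ∀ {v} {f g h : Fin v → Bool} → (∀ y → f y ≡ g y ∧ h y) → ∀ L → allᵇ f L ≡ allᵇ g L ∧ allᵇ h L
allᵇ-split {g = g} {h} f≡g∧h L = trans (allᵇ-cong f≡g∧h L) (sym (allᵇ-∧ g h L))

allᵇ-true : ∀ {v} (L : List (Fin v)) → allᵇ (λ _ → true) L ≡ true
allᵇ-true []       = refl
allᵇ-true (y ∷ ys) = allᵇ-true ys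

module _ {v} (f : Fin v → Bool) (x : Fin v) (f-true : ∀ y → y ≡ᶠ x ≡ false → f y ≡ true) where

  allᵇ-∉ : ∀ L → x ∈ᵇ L ≡ false → allᵇ f L ≡ true
  allᵇ-∉ []       _ = refl
  allᵇ-∉ (y ∷ ys) x∉ with y ≡ᶠ x in y≢x
  ... | false rewrite f-true y y≢x = allᵇ-∉ ys x∉

  allᵇ-∈ : ∀ L → x ∈ᵇ L ≡ true → allᵇ f L ≡ f x
  allᵇ-∈ (y ∷ ys) x∈ with y ≡ᶠ x in y≡x
  ... | false rewrite f-true y y≡x = allᵇ-∈ ys x∈
  ... | true rewrite ≡ᶠ⇒≡ y≡x with x ∈ᵇ ys in x∈ys
  ...   | true  rewrite allᵇ-∈ ys x∈ys = BP.∧-idem (f x)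
  ...   | false rewrite allᵇ-∉ ys x∈ys = BP.∧-identityʳ (f x)

-- N bounds one gadget chain; each of the s nodes gets at most two chains, and the source one more
quadratic-bound : ∀ k N X → let s = suc k in
                  N ℕ.≤ 4 ℕ.* s → X ℕ.≤ N ℕ.+ s ℕ.* suc (N ℕ.+ N) → X ℕ.≤ 13 ℕ.* s ^ 2 ℕ.+ 13
quadratic-bound k N X N≤ X≤ = begin
  X                                       ≤⟨ X≤ ⟩
  N ℕ.+ s ℕ.* suc (N ℕ.+ N)               ≤⟨ ℕP.+-mono-≤ N≤ (ℕP.*-monoʳ-≤ s (s≤s (ℕP.+-mono-≤ N≤ N≤))) ⟩
  4 ℕ.* s ℕ.+ s ℕ.* suc (4 ℕ.* s ℕ.+ 4 ℕ.* s) ≡⟨ expand s ⟩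
  5 ℕ.* s ℕ.+ 8 ℕ.* (s ℕ.* s)             ≤⟨ ℕP.+-monoˡ-≤ _ (ℕP.*-monoʳ-≤ 5 (ℕP.m≤m*n s s)) ⟩
  5 ℕ.* (s ℕ.* s) ℕ.+ 8 ℕ.* (s ℕ.* s)     ≡⟨ collect s ⟩
  13 ℕ.* s ^ 2                            ≤⟨ ℕP.m≤m+n _ 13 ⟩
  13 ℕ.* s ^ 2 ℕ.+ 13                     ∎
  where
  open ℕP.≤-Reasoning
  open +-*-Solver
  s : ℕ
  s = suc k
  expand : ∀ s → 4 ℕ.* s ℕ.+ s ℕ.* suc (4 ℕ.* s ℕ.+ 4 ℕ.* s) ≡ 5 ℕ.* s ℕ.+ 8 ℕ.* (s ℕ.* s)
  expand = solve 1 (λ s → con 4 :* s :+ s :* (con 1 :+ (con 4 :* s :+ con 4 :* s)) := con 5 :* s :+ con 8 :* (s :* s)) refl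
  collect : ∀ s → 5 ℕ.* (s ℕ.* s) ℕ.+ 8 ℕ.* (s ℕ.* s) ≡ 13 ℕ.* s ^ 2
  collect = solve 1 (λ s → con 5 :* (s :* s) :+ con 8 :* (s :* s) := con 13 :* (s :^ 2)) refl

module Constructions {c ℓ₁ ℓ₂ : Level} (F : OrderedField c ℓ₁ ℓ₂) where
  open Circuits F
  open OrderedField F using (Carrier; _≈_; _+_; _*_; 0#; 1#)
  module R = OrderedField F

  -- Occurs, InVar and the structural properties are reflected into Bool, so that the
  -- variable sets of the rebuilt circuits can be computed
  occurs : ∀ {v k} → Circ v k → Fin k → Fin v → Bool → Bool
  occurs (nd ∷ C)               (suc i) x b = occurs C i x b
  occurs (leaf (const _) ∷ C)   zero    x b = false
  occurs (leaf (lit y p) ∷ C)   zero    x b = y ≡ᶠ x ∧ p ≡ᵇ b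
  occurs (gate _ j₁ j₂ ∷ C)     zero    x b = occurs C j₁ x b ∨ occurs C j₂ x b

  hasVar : ∀ {v k} → Circ v k → Fin k → Fin v → Bool
  hasVar C i x = occurs C i x true ∨ occurs C i x false

  shift-gate : ∀ {v k} {n : Node v k} {o j₁ j₂} → shift n ≡ gate o j₁ j₂ →
               Σ (Fin k) λ a → Σ (Fin k) λ b → n ≡ gate o a b × j₁ ≡ suc a × j₂ ≡ suc b
  shift-gate {n = gate o a b} refl = a , b , refl , refl , refl

  shift-leaf : ∀ {v k} {n : Node v k} {l} → shift n ≡ leaf l → n ≡ leaf l
  shift-leaf {n = leaf l} refl = refl

  module _ {v k} {nd : Node v k} {C : Circ v k} where

    succ-lift : ∀ {i j} → Succ C i j → Succ (nd ∷ C) (suc i) (suc j)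
    succ-lift (left e)  = left (cong shift e)
    succ-lift (right e) = right (cong shift e)

    succ-unlift : ∀ {i j} → Succ (nd ∷ C) (suc i) j → Σ (Fin k) λ j′ → j ≡ suc j′ × Succ C i j′
    succ-unlift (left e) with shift-gate e
    ... | a , _ , e′ , refl , refl = a , refl , left e′
    succ-unlift (right e) with shift-gate e
    ... | _ , b , e′ , refl , refl = b , refl , right e′

    succ-head : ∀ {j} → Succ (nd ∷ C) zero j → Σ Op λ o → Σ (Fin k) λ a → Σ (Fin k) λ b →
                nd ≡ gate o a b × (j ≡ suc a ⊎ j ≡ suc b)
    succ-head (left e) with shift-gate e
    ... | a , b , e′ , refl , refl = _ , a , b , e′ , inj₁ refl
    succ-head (right e) with shift-gate e
    ... | a , b , e′ , refl , refl = _ , a , b , e′ , inj₂ refl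

    reach-lift : ∀ {i j} → Reach C i j → Reach (nd ∷ C) (suc i) (suc j)
    reach-lift = gmap suc succ-lift

    reach-unlift : ∀ {i j} → Reach (nd ∷ C) (suc i) j → Σ (Fin k) λ j′ → j ≡ suc j′ × Reach C i j′
    reach-unlift ε = _ , refl , ε
    reach-unlift (s ◅ r) with succ-unlift s
    ... | _ , refl , s′ with reach-unlift r
    ...   | j′ , refl , r′ = j′ , refl , s′ ◅ r′

  occurs⇒Occurs : ∀ {v k} (C : Circ v k) i x b → occurs C i x b ≡ true → Occurs C i x b
  occurs⇒Occurs (nd ∷ C) (suc i) x b h with occurs⇒Occurs C i x b h
  ... | j , r , e = suc j , reach-lift r , cong shift e
  occurs⇒Occurs (leaf (lit y p) ∷ C) zero x b h
    with ≡ᶠ⇒≡ {x = y} {x} (BP.∧-conicalˡ _ _ h) | ≡ᵇ⇒≡ {p} {b} (BP.∧-conicalʳ (y ≡ᶠ x) _ h)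
  ... | refl | refl = zero , ε , refl
  occurs⇒Occurs (gate o j₁ j₂ ∷ C) zero x b h with ∨-true h
  ... | inj₁ h₁ with occurs⇒Occurs C j₁ x b h₁
  ...   | j , r , e = suc j , left refl ◅ reach-lift r , cong shift e
  occurs⇒Occurs (gate o j₁ j₂ ∷ C) zero x b h | inj₂ h₂ with occurs⇒Occurs C j₂ x b h₂
  ...   | j , r , e = suc j , right refl ◅ reach-lift r , cong shift e

  Occurs⇒occurs : ∀ {v k} (C : Circ v k) i x b → Occurs C i x b → occurs C i x b ≡ true
  Occurs⇒occurs (nd ∷ C) (suc i) x b (j , r , e) with reach-unlift r
  ... | j′ , refl , r′ = Occurs⇒occurs C i x b (j′ , r′ , shift-leaf e)
  Occurs⇒occurs (nd ∷ C) zero x b (j , ε , e) with shift-leaf {n = nd} e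
  ... | refl rewrite ≡ᶠ-refl x = ≡⇒≡ᵇ {b} refl
  Occurs⇒occurs (nd ∷ C) zero x b (j , s ◅ r , e) with succ-head s
  ... | _ , a , _ , refl , inj₁ refl with reach-unlift r
  ...   | j′ , refl , r′ = ∨-trueˡ (Occurs⇒occurs C a x b (j′ , r′ , shift-leaf e))
  Occurs⇒occurs (nd ∷ C) zero x b (j , s ◅ r , e) | _ , a , a′ , refl , inj₂ refl with reach-unlift r
  ...   | j′ , refl , r′ = ∨-trueʳ {occurs C a x b} (Occurs⇒occurs C a′ x b (j′ , r′ , shift-leaf e))

  InVar⇒hasVar : ∀ {v k} (C : Circ v k) i x → InVar C i x → hasVar C i x ≡ true
  InVar⇒hasVar C i x (true  , o) = ∨-trueˡ (Occurs⇒occurs C i x true o)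
  InVar⇒hasVar C i x (false , o) = ∨-trueʳ {occurs C i x true} (Occurs⇒occurs C i x false o)

  hasVar⇒InVar : ∀ {v k} (C : Circ v k) i x → hasVar C i x ≡ true → InVar C i x
  hasVar⇒InVar C i x h with ∨-true h
  ... | inj₁ h₁ = true  , occurs⇒Occurs C i x true h₁
  ... | inj₂ h₂ = false , occurs⇒Occurs C i x false h₂

  Smoothᵇ : ∀ {v k} → Circ v k → Set c
  Smoothᵇ C = ∀ i {a b} → nodeAt C i ≡ gate plus a b → ∀ x → hasVar C a x ≡ hasVar C b x

  Decomposableᵇ : ∀ {v k} → Circ v k → Set c
  Decomposableᵇ C = ∀ i {a b} → nodeAt C i ≡ gate times a b →
                    ∀ x → hasVar C a x ≡ true → hasVar C b x ≡ true → ⊥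

  WeaklyDecomposableᵇ : ∀ {v k} → Circ v k → Set c
  WeaklyDecomposableᵇ C = ∀ i {a b} → nodeAt C i ≡ gate times a b →
                          ∀ x → hasVar C a x ≡ true → hasVar C b x ≡ true →
                          occurs C i x true ≡ true → occurs C i x false ≡ true → ⊥

  module _ {v k} {nd : Node v k} {C : Circ v k} where

    Smoothᵇ-tail : Smoothᵇ (nd ∷ C) → Smoothᵇ C
    Smoothᵇ-tail h i e = h (suc i) (cong shift e)

    Decomposableᵇ-tail : Decomposableᵇ (nd ∷ C) → Decomposableᵇ C
    Decomposableᵇ-tail h i e = h (suc i) (cong shift e)

    WeaklyDecomposableᵇ-tail : WeaklyDecomposableᵇ (nd ∷ C) → WeaklyDecomposableᵇ C
    WeaklyDecomposableᵇ-tail h i e = h (suc i) (cong shift e)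

  module _ {v k} (C : Circ v (suc k)) where

    Smooth⇒Smoothᵇ : Smooth (k , C) → Smoothᵇ C
    Smooth⇒Smoothᵇ h i e x = true⇔true⇒≡
      (λ p → InVar⇒hasVar C _ x (Equivalence.to   (h i _ _ e x) (hasVar⇒InVar C _ x p)))
      (λ p → InVar⇒hasVar C _ x (Equivalence.from (h i _ _ e x) (hasVar⇒InVar C _ x p)))

    Smoothᵇ⇒Smooth : Smoothᵇ C → Smooth (k , C)
    Smoothᵇ⇒Smooth h i j₁ j₂ e x =
      mk⇔ (λ p → hasVar⇒InVar C j₂ x (trans (sym (h i e x)) (InVar⇒hasVar C j₁ x p)))
          (λ p → hasVar⇒InVar C j₁ x (trans (h i e x) (InVar⇒hasVar C j₂ x p)))

    Decomposable⇒Decomposableᵇ : Decomposable (k , C) → Decomposableᵇ C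
    Decomposable⇒Decomposableᵇ h i e x p q = h i _ _ e x (hasVar⇒InVar C _ x p , hasVar⇒InVar C _ x q)

    Decomposableᵇ⇒Decomposable : Decomposableᵇ C → Decomposable (k , C)
    Decomposableᵇ⇒Decomposable h i j₁ j₂ e x (p , q) = h i e x (InVar⇒hasVar C j₁ x p) (InVar⇒hasVar C j₂ x q)

    WeaklyDecomposable⇒WeaklyDecomposableᵇ : WeaklyDecomposable (k , C) → WeaklyDecomposableᵇ C
    WeaklyDecomposable⇒WeaklyDecomposableᵇ h i e x p q r s =
      h i _ _ e x (hasVar⇒InVar C _ x p) (hasVar⇒InVar C _ x q) (occurs⇒Occurs C i x true r , occurs⇒Occurs C i x false s)

  SDNode : ∀ {v k} → Node v k → Circ v k → Set
  SDNode (leaf _)         C = ⊤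
  SDNode (gate plus a b)  C = ∀ x → hasVar C a x ≡ hasVar C b x
  SDNode (gate times a b) C = ∀ x → hasVar C a x ≡ true → hasVar C b x ≡ true → ⊥

  SD : ∀ {v k} → Circ v k → Set
  SD []       = ⊤
  SD (nd ∷ C) = SDNode nd C × SD C

  SD⇒Smoothᵇ : ∀ {v k} (C : Circ v k) → SD C → Smoothᵇ C
  SD⇒Smoothᵇ (nd ∷ C) (g , _) zero e x with shift-gate {n = nd} e
  ... | _ , _ , refl , refl , refl = g x
  SD⇒Smoothᵇ (nd ∷ C) (_ , gs) (suc i) e x with shift-gate {n = nodeAt C i} e
  ... | _ , _ , e′ , refl , refl = SD⇒Smoothᵇ C gs i e′ x

  SD⇒Decomposableᵇ : ∀ {v k} (C : Circ v k) → SD C → Decomposableᵇ C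
  SD⇒Decomposableᵇ (nd ∷ C) (g , _) zero e x with shift-gate {n = nd} e
  ... | _ , _ , refl , refl , refl = g x
  SD⇒Decomposableᵇ (nd ∷ C) (_ , gs) (suc i) e x with shift-gate {n = nodeAt C i} e
  ... | _ , _ , e′ , refl , refl = SD⇒Decomposableᵇ C gs i e′ x

  data Extends {v k} (D : Circ v k) : ∀ {k′} → Circ v k′ → Set c where
    here  : Extends D D
    there : ∀ {k′} {D′ : Circ v k′} {nd : Node v k′} → Extends D D′ → Extends D (nd ∷ D′)

  embed : ∀ {v k k′} {D : Circ v k} {D′ : Circ v k′} → Extends D D′ → Fin k → Fin k′
  embed here      i = i
  embed (there e) i = suc (embed e i)

  module _ {v k} {D : Circ v k} where

    occurs-embed : ∀ {k′} {D′ : Circ v k′} (e : Extends D D′) → ∀ i x b → occurs D′ (embed e i) x b ≡ occurs D i x b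
    occurs-embed here      i x b = refl
    occurs-embed (there e) i x b = occurs-embed e i x b

    hasVar-embed : ∀ {k′} {D′ : Circ v k′} (e : Extends D D′) → ∀ i x → hasVar D′ (embed e i) x ≡ hasVar D i x
    hasVar-embed e i x = cong₂ _∨_ (occurs-embed e i x true) (occurs-embed e i x false)

    value-embed : ∀ {k′} {D′ : Circ v k′} (e : Extends D D′) → ∀ i a → lookup (values D′ a) (embed e i) ≡ lookup (values D a) i
    value-embed here      i a = refl
    value-embed (there e) i a = value-embed e i a

    reach-embed : ∀ {k′} {D′ : Circ v k′} (e : Extends D D′) → ∀ {i j} → Reach D i j → Reach D′ (embed e i) (embed e j)
    reach-embed here      r = r
    reach-embed (there e) r = reach-lift (reach-embed e r)

  -- Gadget chains

  data Factor : Set where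
    literal : Bool → Factor
    both    : Factor

  Gadget : ℕ → Set
  Gadget v = Fin v × Factor

  record Extension {v k} (D : Circ v k) : Set c where
    constructor extension
    field
      width : ℕ
      circ  : Circ v width
      ext   : Extends D circ
      root  : Fin width
  open Extension public

  -- the gadget (x , literal b) multiplies the root by the literal x^b, (x , both) by (x̄ + x)
  attach : ∀ {v k} {D : Circ v k} → Gadget v → Extension D → Extension D
  attach (x , literal b) (extension w C e t) =
    extension (suc (suc w)) (gate times zero (suc t) ∷ leaf (lit x b) ∷ C) (there (there e)) zero
  attach (x , both) (extension w C e t) =
    extension (suc (suc (suc (suc w))))
      (gate times zero (suc (suc (suc t))) ∷ gate plus zero (suc zero) ∷ leaf (lit x false) ∷ leaf (lit x true) ∷ C)
      (there (there (there (there e)))) zero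

  attachAll : ∀ {v k} → List (Gadget v) → (D : Circ v k) → Fin k → Extension D
  attachAll []      D t = extension _ D here t
  attachAll (g ∷ G) D t = attach g (attachAll G D t)

  factorOccurs : Factor → Bool → Bool
  factorOccurs (literal p) b = p ≡ᵇ b
  factorOccurs both        b = true

  gadgetsOccur : ∀ {v} → List (Gadget v) → Fin v → Bool → Bool
  gadgetsOccur []            x b = false
  gadgetsOccur ((y , f) ∷ G) x b = (y ≡ᶠ x ∧ factorOccurs f b) ∨ gadgetsOccur G x b

  gadgetsHaveVar : ∀ {v} → List (Gadget v) → Fin v → Bool
  gadgetsHaveVar G x = gadgetsOccur G x true ∨ gadgetsOccur G x false

  factorSize : Factor → ℕ
  factorSize (literal _) = 2
  factorSize both        = 4

  gadgetsSize : ∀ {v} → List (Gadget v) → ℕ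
  gadgetsSize []            = 0
  gadgetsSize ((_ , f) ∷ G) = factorSize f ℕ.+ gadgetsSize G

  hasVar-gate : ∀ {v k} (D : Circ v k) o a b x → hasVar (gate o a b ∷ D) zero x ≡ hasVar D a x ∨ hasVar D b x
  hasVar-gate D o a b x = ∨-interchange (occurs D a x true) (occurs D b x true) (occurs D a x false) (occurs D b x false)

  module _ {v k} (D : Circ v k) (t : Fin k) where

    attachAll-occurs : ∀ G x b → occurs (circ (attachAll G D t)) (root (attachAll G D t)) x b ≡ gadgetsOccur G x b ∨ occurs D t x b
    attachAll-occurs [] x b = refl
    attachAll-occurs ((y , literal p) ∷ G) x b rewrite attachAll-occurs G x b =
      sym (BP.∨-assoc (y ≡ᶠ x ∧ p ≡ᵇ b) _ _)
    attachAll-occurs ((y , both) ∷ G) x b rewrite attachAll-occurs G x b | both-occurs (y ≡ᶠ x) b =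
      sym (BP.∨-assoc (y ≡ᶠ x ∧ true) _ _)

    attachAll-hasVar : ∀ G x → hasVar (circ (attachAll G D t)) (root (attachAll G D t)) x ≡ gadgetsHaveVar G x ∨ hasVar D t x
    attachAll-hasVar G x rewrite attachAll-occurs G x true | attachAll-occurs G x false =
      ∨-interchange (gadgetsOccur G x true) (occurs D t x true) (gadgetsOccur G x false) (occurs D t x false)

  hasVar-literal : ∀ {v k} (y : Fin v) p (D : Circ v k) x → hasVar (leaf (lit y p) ∷ D) zero x ≡ y ≡ᶠ x
  hasVar-literal y p D x with y ≡ᶠ x
  hasVar-literal y true  D x | true  = refl
  hasVar-literal y false D x | true  = refl
  hasVar-literal y p     D x | false = refl

  hasVar-both : ∀ {v k} (y : Fin v) (D : Circ v k) x →
                hasVar (gate plus zero (suc zero) ∷ leaf (lit y false) ∷ leaf (lit y true) ∷ D) zero x ≡ y ≡ᶠ x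
  hasVar-both y D x with y ≡ᶠ x
  ... | true  = refl
  ... | false = refl

  -- each gadget variable is fresh for the rest of the chain, so the new ×-gates are decomposable
  Attachable : ∀ {v k} → List (Gadget v) → Circ v k → Fin k → Set
  Attachable []            D t = ⊤
  Attachable ((y , _) ∷ G) D t = gadgetsHaveVar G y ≡ false × hasVar D t y ≡ false × Attachable G D t

  module _ {v k} (D : Circ v k) (t : Fin k) where

    attachAll-SD : ∀ G → SD D → Attachable G D t → SD (circ (attachAll G D t))
    attachAll-SD [] sd _ = sd
    attachAll-SD ((y , literal p) ∷ G) sd (y∉G , y∉t , ok) = fresh , tt , attachAll-SD G sd ok
      where
      E : Extension D
      E = attachAll G D t
      fresh : ∀ x → hasVar (leaf (lit y p) ∷ circ E) zero x ≡ true → hasVar (circ E) (root E) x ≡ true → ⊥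
      fresh x h₁ h₂ with ≡ᶠ⇒≡ {x = y} {x} (trans (sym (hasVar-literal y p (circ E) x)) h₁)
      ... | refl = true≢false h₂ (trans (attachAll-hasVar D t G y) (cong₂ _∨_ y∉G y∉t))
    attachAll-SD ((y , both) ∷ G) sd (y∉G , y∉t , ok) = fresh , balanced , tt , tt , attachAll-SD G sd ok
      where
      E : Extension D
      E = attachAll G D t
      fresh : ∀ x → hasVar (gate plus zero (suc zero) ∷ leaf (lit y false) ∷ leaf (lit y true) ∷ circ E) zero x ≡ true →
              hasVar (circ E) (root E) x ≡ true → ⊥
      fresh x h₁ h₂ with ≡ᶠ⇒≡ {x = y} {x} (trans (sym (hasVar-both y (circ E) x)) h₁)
      ... | refl = true≢false h₂ (trans (attachAll-hasVar D t G y) (cong₂ _∨_ y∉G y∉t))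
      balanced : ∀ x → hasVar (leaf (lit y false) ∷ leaf (lit y true) ∷ circ E) zero x ≡
                       hasVar (leaf (lit y false) ∷ leaf (lit y true) ∷ circ E) (suc zero) x
      balanced x = trans (hasVar-literal y false (leaf (lit y true) ∷ circ E) x) (sym (hasVar-literal y true (circ E) x))

    attachAll-reach : ∀ G → Reach (circ (attachAll G D t)) (root (attachAll G D t)) (embed (ext (attachAll G D t)) t)
    attachAll-reach [] = ε
    attachAll-reach ((_ , literal _) ∷ G) = right refl ◅ reach-lift (reach-lift (attachAll-reach G))
    attachAll-reach ((_ , both) ∷ G) = right refl ◅ reach-lift (reach-lift (reach-lift (reach-lift (attachAll-reach G))))

    attachAll-cover : ∀ G (j : Fin (width (attachAll G D t))) →
                      (Σ (Fin k) λ j′ → j ≡ embed (ext (attachAll G D t)) j′) ⊎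
                      Reach (circ (attachAll G D t)) (root (attachAll G D t)) j
    attachAll-cover [] j = inj₁ (j , refl)
    attachAll-cover ((_ , literal _) ∷ G) zero       = inj₂ ε
    attachAll-cover ((_ , literal _) ∷ G) (suc zero) = inj₂ (left refl ◅ ε)
    attachAll-cover ((_ , literal _) ∷ G) (suc (suc j)) with attachAll-cover G j
    ... | inj₁ (j′ , refl) = inj₁ (j′ , refl)
    ... | inj₂ r = inj₂ (right refl ◅ reach-lift (reach-lift r))
    attachAll-cover ((_ , both) ∷ G) zero                   = inj₂ ε
    attachAll-cover ((_ , both) ∷ G) (suc zero)             = inj₂ (left refl ◅ ε)
    attachAll-cover ((_ , both) ∷ G) (suc (suc zero))       = inj₂ (left refl ◅ left refl ◅ ε)
    attachAll-cover ((_ , both) ∷ G) (suc (suc (suc zero))) = inj₂ (left refl ◅ right refl ◅ ε)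
    attachAll-cover ((_ , both) ∷ G) (suc (suc (suc (suc j)))) with attachAll-cover G j
    ... | inj₁ (j′ , refl) = inj₁ (j′ , refl)
    ... | inj₂ r = inj₂ (right refl ◅ reach-lift (reach-lift (reach-lift (reach-lift r))))

    attachAll-width : ∀ G → width (attachAll G D t) ≡ gadgetsSize G ℕ.+ k
    attachAll-width []                    = refl
    attachAll-width ((_ , literal _) ∷ G) = cong (2 ℕ.+_) (attachAll-width G)
    attachAll-width ((_ , both) ∷ G)      = cong (4 ℕ.+_) (attachAll-width G)

  data IsZero : ∀ {n} → Fin n → Set where
    isZero : ∀ {n} → IsZero {suc n} zero

  attachAll-isZero : ∀ {v k} G (D : Circ v k) t → IsZero t → IsZero (root (attachAll G D t))
  attachAll-isZero []                    D t z = z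
  attachAll-isZero ((_ , literal _) ∷ G) D t z = isZero
  attachAll-isZero ((_ , both) ∷ G)      D t z = isZero

  toF : Bool → Carrier
  toF true  = 1#
  toF false = 0#

  toF-∧ : ∀ p q → toF (p ∧ q) ≈ toF p * toF q
  toF-∧ true  q = R.sym (R.*-identityˡ (toF q))
  toF-∧ false q = R.sym (R.zeroˡ (toF q))

  literal-value : ∀ {v} (a : Assignment v) y p → evalLabel a (lit y p) ≈ toF (p ≡ᵇ a y)
  literal-value a y true  with a y
  ... | true  = R.refl
  ... | false = R.refl
  literal-value a y false with a y
  ... | true  = R.refl
  ... | false = R.refl

  gadgetValue : ∀ {v} → Assignment v → Gadget v → Carrier
  gadgetValue a (y , literal p) = evalLabel a (lit y p)
  gadgetValue a (y , both)      = evalLabel a (lit y false) + evalLabel a (lit y true)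

  gadgetsProduct : ∀ {v} → Assignment v → List (Gadget v) → Carrier
  gadgetsProduct a []      = 1#
  gadgetsProduct a (g ∷ G) = gadgetValue a g * gadgetsProduct a G

  attachAll-value : ∀ {v k} G (D : Circ v k) t a →
    lookup (values (circ (attachAll G D t)) a) (root (attachAll G D t)) ≈ gadgetsProduct a G * lookup (values D a) t
  attachAll-value []                    D t a = R.sym (R.*-identityˡ _)
  attachAll-value ((_ , literal _) ∷ G) D t a = R.trans (R.*-cong R.refl (attachAll-value G D t a)) (R.sym (R.*-assoc _ _ _))
  attachAll-value ((_ , both) ∷ G)      D t a = R.trans (R.*-cong R.refl (attachAll-value G D t a)) (R.sym (R.*-assoc _ _ _))

  gadgetsFor : ∀ {v} → (Fin v → Bool) → (Fin v → Factor) → List (Fin v) → List (Gadget v)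
  gadgetsFor p f []       = []
  gadgetsFor p f (y ∷ ys) = if p y then (y , f y) ∷ gadgetsFor p f ys else gadgetsFor p f ys

  product-literals : ∀ {v} (a : Assignment v) (p q : Fin v → Bool) L →
    gadgetsProduct a (gadgetsFor p (λ y → literal (q y)) L) ≈ toF (allᵇ (λ y → p y ⇒ᵇ q y ≡ᵇ a y) L)
  product-literals a p q [] = R.refl
  product-literals a p q (y ∷ ys) with p y
  ... | true  = R.trans (R.*-cong (literal-value a y (q y)) (product-literals a p q ys)) (R.sym (toF-∧ (q y ≡ᵇ a y) _))
  ... | false = product-literals a p q ys

  product-both : ∀ {v} (a : Assignment v) (p : Fin v → Bool) L → gadgetsProduct a (gadgetsFor p (λ _ → both) L) ≈ 1#
  product-both a p [] = R.refl
  product-both a p (y ∷ ys) with p y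
  ... | true  = R.trans (R.*-cong (both-value (a y)) (product-both a p ys)) (R.*-identityˡ 1#)
    where
    both-value : ∀ b → (if b then 0# else 1#) + (if b then 1# else 0#) ≈ 1#
    both-value true  = R.+-identityˡ 1#
    both-value false = R.+-identityʳ 1#
  ... | false = product-both a p ys

  gadgetsFor-occurs : ∀ {v} p f (L : List (Fin v)) x b → gadgetsOccur (gadgetsFor p f L) x b ≡ x ∈ᵇ L ∧ (p x ∧ factorOccurs (f x) b)
  gadgetsFor-occurs p f [] x b = refl
  gadgetsFor-occurs p f (y ∷ ys) x b with p y in py | y ≡ᶠ x in y≡x
  ... | true  | false rewrite y≡x = gadgetsFor-occurs p f ys x b
  ... | false | false = gadgetsFor-occurs p f ys x b
  ... | true  | true with ≡ᶠ⇒≡ y≡x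
  ...   | refl rewrite ≡ᶠ-refl y | gadgetsFor-occurs p f ys y b | py = absorb (factorOccurs (f y) b) (y ∈ᵇ ys)
    where
    absorb : ∀ e m → e ∨ (m ∧ e) ≡ e
    absorb true  m = refl
    absorb false m = BP.∧-zeroʳ m
  gadgetsFor-occurs p f (y ∷ ys) x b | false | true with ≡ᶠ⇒≡ y≡x
  ...   | refl rewrite ≡ᶠ-refl y | gadgetsFor-occurs p f ys y b | py = BP.∧-zeroʳ (y ∈ᵇ ys)

  gadgetsFor-hasVar : ∀ {v} p f (L : List (Fin v)) x → gadgetsHaveVar (gadgetsFor p f L) x ≡ x ∈ᵇ L ∧ p x
  gadgetsFor-hasVar p f L x rewrite gadgetsFor-occurs p f L x true | gadgetsFor-occurs p f L x false =
    factor-or (x ∈ᵇ L) (p x) (f x)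
    where
    factor-or : ∀ m q f → (m ∧ (q ∧ factorOccurs f true)) ∨ (m ∧ (q ∧ factorOccurs f false)) ≡ m ∧ q
    factor-or false q     f               = refl
    factor-or true  false f               = refl
    factor-or true  true  (literal true)  = refl
    factor-or true  true  (literal false) = refl
    factor-or true  true  both            = refl

  gadgetsFor-attachable : ∀ {v k} p f (L : List (Fin v)) (D : Circ v k) t → Distinct L →
                          (∀ y → p y ≡ true → hasVar D t y ≡ false) → Attachable (gadgetsFor p f L) D t
  gadgetsFor-attachable p f [] D t _ _ = tt
  gadgetsFor-attachable p f (y ∷ ys) D t (y∉ys , distinct) fresh with p y in py
  ... | true  = trans (gadgetsFor-hasVar p f ys y) (cong (_∧ p y) y∉ys) , fresh y py ,
                gadgetsFor-attachable p f ys D t distinct fresh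
  ... | false = gadgetsFor-attachable p f ys D t distinct fresh

  gadgetsFor-size : ∀ {v} p f (L : List (Fin v)) → gadgetsSize (gadgetsFor p f L) ℕ.≤ 4 ℕ.* length L
  gadgetsFor-size p f [] = z≤n
  gadgetsFor-size p f (y ∷ ys) with p y
  ... | false = ℕP.≤-trans (gadgetsFor-size p f ys) (ℕP.*-monoʳ-≤ 4 (ℕP.n≤1+n _))
  ... | true  = ℕP.≤-trans (ℕP.+-mono-≤ (factorSize≤4 (f y)) (gadgetsFor-size p f ys))
                           (ℕP.≤-reflexive (sym (ℕP.*-suc 4 (length ys))))
    where
    factorSize≤4 : ∀ f → factorSize f ℕ.≤ 4
    factorSize≤4 (literal _) = ℕP.m≤m+n 2 2
    factorSize≤4 both        = ℕP.≤-refl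

  -- Bottom-up reconstruction

  module Rebuild {v} (relabel : Label v → Label v)
                 (padˡ padʳ : ∀ {k} → Circ v k → Op → Fin k → Fin k → List (Gadget v)) where

    record Rebuilt (k : ℕ) : Set c where
      constructor rebuilt
      field
        len   : ℕ
        out   : Circ v len
        image : Fin k → Fin len
    open Rebuilt public

    -- node  gate o a b  of T becomes  (padˡ · a′) o (padʳ · b′)  on top of the rebuilt tail r
    module Gate {k} (T : Circ v k) (o : Op) (a b : Fin k) (r : Rebuilt k) where

      lhs : Extension (out r)
      lhs = attachAll (padˡ T o a b) (out r) (image r a)

      rhs : Extension (circ lhs)
      rhs = attachAll (padʳ T o a b) (circ lhs) (embed (ext lhs) (image r b))

      top : Node v (width rhs)
      top = gate o (embed (ext rhs) (root lhs)) (root rhs)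

      embedGate : Fin (len r) → Fin (suc (width rhs))
      embedGate j = suc (embed (ext rhs) (embed (ext lhs) j))

      width-rhs : width rhs ≡ gadgetsSize (padʳ T o a b) ℕ.+ (gadgetsSize (padˡ T o a b) ℕ.+ len r)
      width-rhs = trans (attachAll-width (circ lhs) (embed (ext lhs) (image r b)) (padʳ T o a b))
                        (cong (gadgetsSize (padʳ T o a b) ℕ.+_) (attachAll-width (out r) (image r a) (padˡ T o a b)))

      occurs-top : ∀ x p → occurs (top ∷ circ rhs) zero x p ≡
                   (gadgetsOccur (padˡ T o a b) x p ∨ occurs (out r) (image r a) x p) ∨
                   (gadgetsOccur (padʳ T o a b) x p ∨ occurs (out r) (image r b) x p)
      occurs-top x p
        rewrite occurs-embed (ext rhs) (root lhs) x p
              | attachAll-occurs (out r) (image r a) (padˡ T o a b) x p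
              | attachAll-occurs (circ lhs) (embed (ext lhs) (image r b)) (padʳ T o a b) x p
              | occurs-embed (ext lhs) (image r b) x p = refl

      hasVar-lhs : ∀ x → hasVar (circ rhs) (embed (ext rhs) (root lhs)) x ≡
                   gadgetsHaveVar (padˡ T o a b) x ∨ hasVar (out r) (image r a) x
      hasVar-lhs x = trans (hasVar-embed (ext rhs) (root lhs) x) (attachAll-hasVar (out r) (image r a) (padˡ T o a b) x)

      hasVar-rhs : ∀ x → hasVar (circ rhs) (root rhs) x ≡ gadgetsHaveVar (padʳ T o a b) x ∨ hasVar (out r) (image r b) x
      hasVar-rhs x = trans (attachAll-hasVar (circ lhs) (embed (ext lhs) (image r b)) (padʳ T o a b) x)
                           (cong (gadgetsHaveVar (padʳ T o a b) x ∨_) (hasVar-embed (ext lhs) (image r b) x))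

      hasVar-top : ∀ x → hasVar (top ∷ circ rhs) zero x ≡
                   (gadgetsHaveVar (padˡ T o a b) x ∨ hasVar (out r) (image r a) x) ∨
                   (gadgetsHaveVar (padʳ T o a b) x ∨ hasVar (out r) (image r b) x)
      hasVar-top x = trans (hasVar-gate (circ rhs) o _ _ x) (cong₂ _∨_ (hasVar-lhs x) (hasVar-rhs x))

      value-lhs : ∀ as → lookup (values (circ rhs) as) (embed (ext rhs) (root lhs)) ≈
                  gadgetsProduct as (padˡ T o a b) * lookup (values (out r) as) (image r a)
      value-lhs as rewrite value-embed (ext rhs) (root lhs) as = attachAll-value (padˡ T o a b) (out r) (image r a) as

      value-rhs : ∀ as → lookup (values (circ rhs) as) (root rhs) ≈
                  gadgetsProduct as (padʳ T o a b) * lookup (values (out r) as) (image r b)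
      value-rhs as rewrite sym (value-embed (ext lhs) (image r b) as) =
        attachAll-value (padʳ T o a b) (circ lhs) (embed (ext lhs) (image r b)) as

      SD-top : SD (out r) → Attachable (padˡ T o a b) (out r) (image r a) →
               Attachable (padʳ T o a b) (circ lhs) (embed (ext lhs) (image r b)) →
               SDNode top (circ rhs) → SD (top ∷ circ rhs)
      SD-top sd okˡ okʳ sdTop = sdTop , attachAll-SD _ _ (padʳ T o a b) (attachAll-SD (out r) (image r a) (padˡ T o a b) sd okˡ) okʳ

      reach-lhs : Reach (top ∷ circ rhs) zero (embedGate (image r a))
      reach-lhs = left refl ◅ reach-lift (reach-embed (ext rhs) (attachAll-reach (out r) (image r a) (padˡ T o a b)))

      reach-rhs : Reach (top ∷ circ rhs) zero (embedGate (image r b))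
      reach-rhs = right refl ◅ reach-lift (attachAll-reach (circ lhs) (embed (ext lhs) (image r b)) (padʳ T o a b))

      cover-top : ∀ j → (Σ (Fin (len r)) λ j′ → j ≡ embedGate j′) ⊎ Reach (top ∷ circ rhs) zero j
      cover-top zero = inj₂ ε
      cover-top (suc j) with attachAll-cover (circ lhs) (embed (ext lhs) (image r b)) (padʳ T o a b) j
      ... | inj₂ ρ = inj₂ (right refl ◅ reach-lift ρ)
      ... | inj₁ (j₁ , refl) with attachAll-cover (out r) (image r a) (padˡ T o a b) j₁
      ...   | inj₂ ρ = inj₂ (left refl ◅ reach-lift (reach-embed (ext rhs) ρ))
      ...   | inj₁ (j′ , refl) = inj₁ (j′ , refl)

    block : ∀ {k} → Node v k → Circ v k → Rebuilt k → Rebuilt (suc k)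
    block (leaf l)     T r = rebuilt (suc (len r)) (leaf (relabel l) ∷ out r) (zero V∷ λ i → suc (image r i))
    block (gate o a b) T r = rebuilt (suc (width rhs)) (top ∷ circ rhs) (zero V∷ λ i → embedGate (image r i))
      where open Gate T o a b r

    rebuild : ∀ {k} → Circ v k → Rebuilt k
    rebuild []       = rebuilt 0 [] (λ ())
    rebuild (nd ∷ T) = block nd T (rebuild T)

    embedNode : ∀ {k} (nd : Node v k) (T : Circ v k) (r : Rebuilt k) → Fin (len r) → Fin (len (block nd T r))
    embedNode (leaf l)     T r = suc
    embedNode (gate o a b) T r = Gate.embedGate T o a b r

    module _ {k} (T : Circ v k) (r : Rebuilt k) where

      block-image : ∀ nd i → image (block nd T r) (suc i) ≡ embedNode nd T r (image r i)
      block-image (leaf _)     i = refl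
      block-image (gate _ _ _) i = refl

      block-occurs : ∀ nd j x p → occurs (out (block nd T r)) (embedNode nd T r j) x p ≡ occurs (out r) j x p
      block-occurs (leaf _)     j x p = refl
      block-occurs (gate o a b) j x p = trans (occurs-embed (ext rhs) _ x p) (occurs-embed (ext lhs) j x p)
        where open Gate T o a b r

      block-hasVar : ∀ nd j x → hasVar (out (block nd T r)) (embedNode nd T r j) x ≡ hasVar (out r) j x
      block-hasVar nd j x = cong₂ _∨_ (block-occurs nd j x true) (block-occurs nd j x false)

      block-value : ∀ nd j as → lookup (values (out (block nd T r)) as) (embedNode nd T r j) ≡ lookup (values (out r) as) j
      block-value (leaf _)     j as = refl
      block-value (gate o a b) j as = trans (value-embed (ext rhs) _ as) (value-embed (ext lhs) j as)
        where open Gate T o a b r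

      block-reach : ∀ nd {i j} → Reach (out r) i j → Reach (out (block nd T r)) (embedNode nd T r i) (embedNode nd T r j)
      block-reach (leaf _)     ρ = reach-lift ρ
      block-reach (gate o a b) ρ = reach-lift (reach-embed (ext rhs) (reach-embed (ext lhs) ρ))
        where open Gate T o a b r

      block-cover : ∀ nd j → (Σ (Fin (len r)) λ j′ → j ≡ embedNode nd T r j′) ⊎
                             Reach (out (block nd T r)) (image (block nd T r) zero) j
      block-cover (leaf _)     zero    = inj₂ ε
      block-cover (leaf _)     (suc j) = inj₁ (j , refl)
      block-cover (gate o a b) j       = Gate.cover-top T o a b r j

      block-isZero : ∀ nd → IsZero (image (block nd T r) zero)
      block-isZero (leaf _)     = isZero
      block-isZero (gate _ _ _) = isZero

    rebuild-cover : ∀ {k} (T : Circ v k) j → Σ (Fin k) λ i → Reach (out (rebuild T)) (image (rebuild T) i) j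
    rebuild-cover (nd ∷ T) j with block-cover T (rebuild T) nd j
    ... | inj₂ ρ = zero , ρ
    ... | inj₁ (j′ , refl) with rebuild-cover T j′
    ...   | i , ρ = suc i , subst (λ z → Reach (out (block nd T (rebuild T))) z (embedNode nd T (rebuild T) j′))
                                  (sym (block-image T (rebuild T) nd i)) (block-reach T (rebuild T) nd ρ)

    rebuild-edge : ∀ {k} (T : Circ v k) {i j} → Succ T i j → Reach (out (rebuild T)) (image (rebuild T) i) (image (rebuild T) j)
    rebuild-edge (nd ∷ T) {zero} s with succ-head s
    ... | o , a , b , refl , inj₁ refl = Gate.reach-lhs T o a b (rebuild T)
    ... | o , a , b , refl , inj₂ refl = Gate.reach-rhs T o a b (rebuild T)
    rebuild-edge (nd ∷ T) {suc i} s with succ-unlift s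
    ... | i′ , refl , s′ rewrite block-image T (rebuild T) nd i | block-image T (rebuild T) nd i′ =
      block-reach T (rebuild T) nd (rebuild-edge T s′)

    rebuild-reach : ∀ {k} (T : Circ v k) {i j} → Reach T i j → Reach (out (rebuild T)) (image (rebuild T) i) (image (rebuild T) j)
    rebuild-reach T ε       = ε
    rebuild-reach T (s ◅ ρ) = rebuild-edge T s ◅◅ rebuild-reach T ρ

    module _ (N : ℕ) (padˡ≤ : ∀ {k} (T : Circ v k) o a b → gadgetsSize (padˡ T o a b) ℕ.≤ N)
                     (padʳ≤ : ∀ {k} (T : Circ v k) o a b → gadgetsSize (padʳ T o a b) ℕ.≤ N) where

      rebuild-len : ∀ {k} (T : Circ v k) → len (rebuild T) ℕ.≤ k ℕ.* suc (N ℕ.+ N)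
      rebuild-len [] = z≤n
      rebuild-len (leaf l ∷ T) = s≤s (ℕP.≤-trans (rebuild-len T) (ℕP.m≤n+m _ (N ℕ.+ N)))
      rebuild-len (gate o a b ∷ T) = s≤s (begin
        width rhs                                                            ≡⟨ width-rhs ⟩
        gadgetsSize (padʳ T o a b) ℕ.+ (gadgetsSize (padˡ T o a b) ℕ.+ len (rebuild T))
          ≤⟨ ℕP.+-mono-≤ (padʳ≤ T o a b) (ℕP.+-mono-≤ (padˡ≤ T o a b) (rebuild-len T)) ⟩
        N ℕ.+ (N ℕ.+ _)                                                      ≡⟨ ℕP.+-assoc N N _ ⟨
        N ℕ.+ N ℕ.+ _                                                        ∎)
        where
        open ℕP.≤-Reasoning
        open Gate T o a b (rebuild T)

    finish : ∀ {k} (G₀ : List (Gadget v)) (C : Circ v (suc k)) → Extension (out (rebuild C))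
    finish G₀ C = attachAll G₀ (out (rebuild C)) (image (rebuild C) zero)

    finish-isZero : ∀ {k} G₀ (C : Circ v (suc k)) → IsZero (root (finish G₀ C))
    finish-isZero G₀ (nd ∷ T) = attachAll-isZero G₀ _ _ (block-isZero T (rebuild T) nd)

    finish-singleSource : ∀ {k} G₀ (C : Circ v (suc k)) → (∀ j → Reach C zero j) →
                          ∀ j → Reach (circ (finish G₀ C)) (root (finish G₀ C)) j
    finish-singleSource G₀ C ss j with attachAll-cover (out (rebuild C)) (image (rebuild C) zero) G₀ j
    ... | inj₂ ρ = ρ
    ... | inj₁ (j′ , refl) with rebuild-cover C j′
    ...   | i , ρ = attachAll-reach (out (rebuild C)) (image (rebuild C) zero) G₀ ◅◅
                    reach-embed (ext (finish G₀ C)) (rebuild-reach C (ss i) ◅◅ ρ)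

  toAC : ∀ {v n} → Circ v n → Fin n → AC v
  toAC (nd ∷ D) _ = _ , nd ∷ D

  toAC-value : ∀ {v n} (D : Circ v n) t → IsZero t → ∀ a → ⟦ toAC D t ⟧ a ≡ lookup (values D a) t
  toAC-value (nd ∷ D) .zero isZero a = refl

  toAC-singleSource : ∀ {v n} (D : Circ v n) t → IsZero t → (∀ j → Reach D t j) → SingleSource (toAC D t)
  toAC-singleSource (nd ∷ D) .zero isZero reach = reach

  toAC-smooth : ∀ {v n} (D : Circ v n) t → SD D → Smooth (toAC D t)
  toAC-smooth (nd ∷ D) t sd = Smoothᵇ⇒Smooth (nd ∷ D) (SD⇒Smoothᵇ (nd ∷ D) sd)

  toAC-decomposable : ∀ {v n} (D : Circ v n) t → SD D → Decomposable (toAC D t)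
  toAC-decomposable (nd ∷ D) t sd = Decomposableᵇ⇒Decomposable (nd ∷ D) (SD⇒Decomposableᵇ (nd ∷ D) sd)

  toAC-size : ∀ {v n} (D : Circ v n) t → size (toAC D t) ≡ n
  toAC-size (nd ∷ D) t = refl

  Positive-resp-≈ : ∀ {v} (C₁ C₂ : AC v) → (∀ a → ⟦ C₁ ⟧ a ≈ ⟦ C₂ ⟧ a) → Positive C₂ → Positive C₁
  Positive-resp-≈ C₁ C₂ C₁≈C₂ pos a = IsTotalOrder.≲-respʳ-≈ R.isTotalOrder (R.sym (C₁≈C₂ a)) (pos a)

  literalVars : ∀ {v k} → Circ v k → List (Fin v)
  literalVars []                   = []
  literalVars (leaf (lit x _) ∷ C) = x ∷ literalVars C
  literalVars (leaf (const _) ∷ C) = literalVars C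
  literalVars (gate _ _ _ ∷ C)     = literalVars C

  literalVars-length : ∀ {v k} (C : Circ v k) → length (literalVars C) ℕ.≤ k
  literalVars-length []                   = z≤n
  literalVars-length (leaf (lit _ _) ∷ C) = s≤s (literalVars-length C)
  literalVars-length (leaf (const _) ∷ C) = ℕP.m≤n⇒m≤1+n (literalVars-length C)
  literalVars-length (gate _ _ _ ∷ C)     = ℕP.m≤n⇒m≤1+n (literalVars-length C)

  Covers : ∀ {v k} → List (Fin v) → Circ v k → Set
  Covers Vs C = ∀ i x b → occurs C i x b ≡ true → x ∈ᵇ Vs ≡ true

  Covers-hasVar : ∀ {v k} {Vs : List (Fin v)} (C : Circ v k) → Covers Vs C → ∀ i x → hasVar C i x ≡ true → x ∈ᵇ Vs ≡ true
  Covers-hasVar C cover i x h with ∨-true h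
  ... | inj₁ h₁ = cover i x true h₁
  ... | inj₂ h₂ = cover i x false h₂

  literalVars-covers : ∀ {v k} (C : Circ v k) → Covers (literalVars C) C
  literalVars-covers (nd ∷ C) (suc i) x b h = literalVars-∷ nd (literalVars-covers C i x b h)
    where
    literalVars-∷ : ∀ nd → x ∈ᵇ literalVars C ≡ true → x ∈ᵇ literalVars (nd ∷ C) ≡ true
    literalVars-∷ (leaf (lit y _)) h = ∨-trueʳ {y ≡ᶠ x} h
    literalVars-∷ (leaf (const _)) h = h
    literalVars-∷ (gate _ _ _)     h = h
  literalVars-covers (leaf (lit y p) ∷ C) zero x b h = ∨-trueˡ (BP.∧-conicalˡ (y ≡ᶠ x) _ h)
  literalVars-covers (gate o j₁ j₂ ∷ C) zero x b h with ∨-true h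
  ... | inj₁ h₁ = literalVars-covers C j₁ x b h₁
  ... | inj₂ h₂ = literalVars-covers C j₂ x b h₂

  -- Smoothing

  -- the padding of a +-gate over Vs ⊇ var(a) ∪ var(b): each side receives the variables it misses
  union-padded : ∀ m va vb → ((m ∧ (vb ∧ not va)) ∨ va) ∨ ((m ∧ (va ∧ not vb)) ∨ vb) ≡ va ∨ vb
  union-padded m va vb = ≡ᵇ⇒≡ (valid-sound 3
    (λ m va vb → (((m ∧ (vb ∧ not va)) ∨ va) ∨ ((m ∧ (va ∧ not vb)) ∨ vb)) ≡ᵇ (va ∨ vb)) refl m va vb)

  padded-balanced : ∀ m va vb → (va ⇒ᵇ m) ≡ true → (vb ⇒ᵇ m) ≡ true →
                    (m ∧ (vb ∧ not va)) ∨ va ≡ (m ∧ (va ∧ not vb)) ∨ vb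
  padded-balanced m va vb va⇒m vb⇒m = ≡ᵇ⇒≡ (⇒ᵇ-mp (⇒ᵇ-mp (valid-sound 3
    (λ m va vb → (va ⇒ᵇ m) ⇒ᵇ (vb ⇒ᵇ m) ⇒ᵇ ((m ∧ (vb ∧ not va)) ∨ va) ≡ᵇ ((m ∧ (va ∧ not vb)) ∨ vb))
    refl m va vb) va⇒m) vb⇒m)

  module Smoothing {v} (Vs : List (Fin v)) where

    missing : ∀ {k} → Circ v k → Fin k → Fin k → Fin v → Bool
    missing T a b y = hasVar T b y ∧ not (hasVar T a y)

    padˡ padʳ : ∀ {k} → Circ v k → Op → Fin k → Fin k → List (Gadget v)
    padˡ T plus  a b = gadgetsFor (missing T a b) (λ _ → both) Vs
    padˡ T times a b = []
    padʳ T plus  a b = gadgetsFor (missing T b a) (λ _ → both) Vs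
    padʳ T times a b = []

    open Rebuild (λ l → l) padˡ padʳ public

    smoothing-hasVar : ∀ {k} (T : Circ v k) i x → hasVar (out (rebuild T)) (image (rebuild T) i) x ≡ hasVar T i x
    smoothing-hasVar (nd ∷ T) (suc i) x rewrite block-image T (rebuild T) nd i =
      trans (block-hasVar T (rebuild T) nd _ x) (smoothing-hasVar T i x)
    smoothing-hasVar (leaf (const _) ∷ T) zero x = refl
    smoothing-hasVar (leaf (lit _ _) ∷ T) zero x = refl
    smoothing-hasVar (gate times a b ∷ T) zero x =
      trans (Gate.hasVar-top T times a b (rebuild T) x)
            (trans (cong₂ _∨_ (smoothing-hasVar T a x) (smoothing-hasVar T b x)) (sym (hasVar-gate T times a b x)))
    smoothing-hasVar (gate plus a b ∷ T) zero x =
      trans (Gate.hasVar-top T plus a b (rebuild T) x)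
            (trans (cong₂ _∨_ (padded a b) (padded b a))
                   (trans (union-padded (x ∈ᵇ Vs) (hasVar T a x) (hasVar T b x)) (sym (hasVar-gate T plus a b x))))
      where
      padded : ∀ a b → gadgetsHaveVar (gadgetsFor (missing T a b) (λ _ → both) Vs) x ∨ hasVar (out (rebuild T)) (image (rebuild T) a) x ≡
                       (x ∈ᵇ Vs ∧ missing T a b x) ∨ hasVar T a x
      padded a b = cong₂ _∨_ (gadgetsFor-hasVar _ _ Vs x) (smoothing-hasVar T a x)

    smoothing-value : ∀ {k} (T : Circ v k) i as → lookup (values (out (rebuild T)) as) (image (rebuild T) i) ≈ lookup (values T as) i
    smoothing-value (nd ∷ T) (suc i) as rewrite block-image T (rebuild T) nd i | block-value T (rebuild T) nd (image (rebuild T) i) as =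
      smoothing-value T i as
    smoothing-value (leaf (const _) ∷ T) zero as = R.refl
    smoothing-value (leaf (lit _ _) ∷ T) zero as = R.refl
    smoothing-value (gate plus a b ∷ T) zero as =
      R.+-cong (R.trans (value-lhs as) (padded a)) (R.trans (value-rhs as) (padded b))
      where
      open Gate T plus a b (rebuild T)
      padded : ∀ a {p} → gadgetsProduct as (gadgetsFor p (λ _ → both) Vs) * lookup (values (out (rebuild T)) as) (image (rebuild T) a) ≈
                         lookup (values T as) a
      padded a = R.trans (R.*-cong (product-both as _ Vs) (smoothing-value T a as)) (R.*-identityˡ _)
    smoothing-value (gate times a b ∷ T) zero as =
      R.*-cong (R.trans (value-lhs as) (R.trans (R.*-identityˡ _) (smoothing-value T a as)))
               (R.trans (value-rhs as) (R.trans (R.*-identityˡ _) (smoothing-value T b as)))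
      where open Gate T times a b (rebuild T)

    smoothing-SD : ∀ {k} (T : Circ v k) → Distinct Vs → Covers Vs T → Decomposableᵇ T → SD (out (rebuild T))
    smoothing-SD [] _ _ _ = tt
    smoothing-SD (leaf _ ∷ T) distinct cover dec = tt , smoothing-SD T distinct (λ i → cover (suc i)) (Decomposableᵇ-tail dec)
    smoothing-SD (gate times a b ∷ T) distinct cover dec =
      Gate.SD-top T times a b (rebuild T) (smoothing-SD T distinct (λ i → cover (suc i)) (Decomposableᵇ-tail dec)) tt tt
        λ x h₁ h₂ → dec zero refl x
          (trans (sym (trans (Gate.hasVar-lhs T times a b (rebuild T) x) (smoothing-hasVar T a x))) h₁)
          (trans (sym (trans (Gate.hasVar-rhs T times a b (rebuild T) x) (smoothing-hasVar T b x))) h₂)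
    smoothing-SD {suc k} (gate plus a b ∷ T) distinct cover dec =
      SD-top (smoothing-SD T distinct (λ i → cover (suc i)) (Decomposableᵇ-tail dec)) okˡ okʳ balanced
      where
      r : Rebuilt k
      r = rebuild T
      open Gate T plus a b r
      missing-fresh : ∀ a b y → missing T a b y ≡ true → hasVar T a y ≡ false
      missing-fresh a b y h = BP.not-injective (BP.∧-conicalʳ (hasVar T b y) _ h)
      okˡ : Attachable (padˡ T plus a b) (out r) (image r a)
      okˡ = gadgetsFor-attachable _ _ Vs _ _ distinct λ y h → trans (smoothing-hasVar T a y) (missing-fresh a b y h)
      okʳ : Attachable (padʳ T plus a b) (circ lhs) (embed (ext lhs) (image r b))
      okʳ = gadgetsFor-attachable _ _ Vs _ _ distinct λ y h →
              trans (hasVar-embed (ext lhs) (image r b) y) (trans (smoothing-hasVar T b y) (missing-fresh b a y h))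
      padded : ∀ a b x → gadgetsHaveVar (gadgetsFor (missing T a b) (λ _ → both) Vs) x ∨ hasVar (out r) (image r a) x ≡
                         (x ∈ᵇ Vs ∧ missing T a b x) ∨ hasVar T a x
      padded a b x = cong₂ _∨_ (gadgetsFor-hasVar _ _ Vs x) (smoothing-hasVar T a x)
      covered : ∀ a x → (hasVar T a x ⇒ᵇ x ∈ᵇ Vs) ≡ true
      covered a x = ⇒ᵇ-intro (Covers-hasVar {Vs = Vs} T (λ i → cover (suc i)) a x)
      balanced : SDNode top (circ rhs)
      balanced x = trans (trans (hasVar-lhs x) (padded a b x))
                         (trans (padded-balanced (x ∈ᵇ Vs) (hasVar T a x) (hasVar T b x) (covered a x) (covered b x))
                                (sym (trans (hasVar-rhs x) (padded b a x))))

  -- Pruning forced literals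

  common-factor-+ : ∀ h l r x y → toF (h ∧ l) * x + toF (h ∧ r) * y ≈ toF h * (toF l * x + toF r * y)
  common-factor-+ h l r x y = begin
    toF (h ∧ l) * x + toF (h ∧ r) * y                   ≈⟨ R.+-cong (R.*-cong (toF-∧ h l) R.refl) (R.*-cong (toF-∧ h r) R.refl) ⟩
    (toF h * toF l) * x + (toF h * toF r) * y           ≈⟨ R.+-cong (R.*-assoc _ _ _) (R.*-assoc _ _ _) ⟩
    toF h * (toF l * x) + toF h * (toF r * y)           ≈⟨ R.distribˡ _ _ _ ⟨
    toF h * (toF l * x + toF r * y)                     ∎
    where open SetoidReasoning R.setoid

  common-factor-* : ∀ A B h l r x y → A ∧ B ≡ h ∧ (l ∧ r) →
                    (toF A * x) * (toF B * y) ≈ toF h * ((toF l * x) * (toF r * y))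
  common-factor-* A B h l r x y A∧B≡ = begin
    (toF A * x) * (toF B * y)                ≈⟨ interchange _ _ _ _ ⟩
    (toF A * toF B) * (x * y)                ≈⟨ R.*-cong (toF-∧ A B) R.refl ⟨
    toF (A ∧ B) * (x * y)                    ≡⟨ cong (λ e → toF e * (x * y)) A∧B≡ ⟩
    toF (h ∧ (l ∧ r)) * (x * y)              ≈⟨ R.*-cong (R.trans (toF-∧ h _) (R.*-cong R.refl (toF-∧ l r))) R.refl ⟩
    (toF h * (toF l * toF r)) * (x * y)      ≈⟨ R.*-assoc _ _ _ ⟩
    toF h * ((toF l * toF r) * (x * y))      ≈⟨ R.*-cong R.refl (interchange _ _ _ _) ⟩
    toF h * ((toF l * x) * (toF r * y))      ∎
    where
    open SetoidReasoning R.setoid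
    open CommSemigroupProperties R.*-commutativeSemigroup using (interchange)

  -- a variable occurring below a child with polarities (pa , na) and below its sibling with (pb , nb)
  -- is forced in that child but mixed at the gate
  forcedIn : Bool → Bool → Bool → Bool → Bool
  forcedIn pa na pb nb = (pa xor na) ∧ ((pa ∨ pb) ∧ (na ∨ nb))

  -- α satisfies the literal forced by the polarities (p , n), if any
  agrees : Bool → Bool → Bool → Bool
  agrees p n α = p xor n ⇒ᵇ p ≡ᵇ α

  agrees-plusˡ : ∀ pa na pb nb α → pa ∨ na ≡ pb ∨ nb →
                 agrees pa na α ≡ agrees (pa ∨ pb) (na ∨ nb) α ∧ (forcedIn pa na pb nb ⇒ᵇ pa ≡ᵇ α)
  agrees-plusˡ pa na pb nb α h = ≡ᵇ⇒≡ (⇒ᵇ-mp (valid-sound 5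
    (λ pa na pb nb α → (pa ∨ na) ≡ᵇ (pb ∨ nb) ⇒ᵇ
       agrees pa na α ≡ᵇ (agrees (pa ∨ pb) (na ∨ nb) α ∧ (forcedIn pa na pb nb ⇒ᵇ pa ≡ᵇ α)))
    refl pa na pb nb α) (≡⇒≡ᵇ h))

  agrees-plusʳ : ∀ pa na pb nb α → pa ∨ na ≡ pb ∨ nb →
                 agrees pb nb α ≡ agrees (pa ∨ pb) (na ∨ nb) α ∧ (forcedIn pb nb pa na ⇒ᵇ pb ≡ᵇ α)
  agrees-plusʳ pa na pb nb α h = ≡ᵇ⇒≡ (⇒ᵇ-mp (valid-sound 5
    (λ pa na pb nb α → (pa ∨ na) ≡ᵇ (pb ∨ nb) ⇒ᵇ
       agrees pb nb α ≡ᵇ (agrees (pa ∨ pb) (na ∨ nb) α ∧ (forcedIn pb nb pa na ⇒ᵇ pb ≡ᵇ α)))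
    refl pa na pb nb α) (≡⇒≡ᵇ h))

  agrees-times : ∀ pa na pb nb α → ((pa ∨ na) ∧ (pb ∨ nb) ⇒ᵇ not ((pa ∨ pb) ∧ (na ∨ nb))) ≡ true →
                 agrees pa na α ∧ agrees pb nb α ≡
                 agrees (pa ∨ pb) (na ∨ nb) α ∧ ((forcedIn pa na pb nb ⇒ᵇ pa ≡ᵇ α) ∧ (forcedIn pb nb pa na ⇒ᵇ pb ≡ᵇ α))
  agrees-times pa na pb nb α h = ≡ᵇ⇒≡ (⇒ᵇ-mp (valid-sound 5
    (λ pa na pb nb α → ((pa ∨ na) ∧ (pb ∨ nb) ⇒ᵇ not ((pa ∨ pb) ∧ (na ∨ nb))) ⇒ᵇ
       (agrees pa na α ∧ agrees pb nb α) ≡ᵇ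
       (agrees (pa ∨ pb) (na ∨ nb) α ∧ ((forcedIn pa na pb nb ⇒ᵇ pa ≡ᵇ α) ∧ (forcedIn pb nb pa na ⇒ᵇ pb ≡ᵇ α))))
    refl pa na pb nb α) h)

  mixed-gate : ∀ m pa na pb nb b → (pa ∨ na ⇒ᵇ m) ≡ true → (pb ∨ nb ⇒ᵇ m) ≡ true →
               ((m ∧ (forcedIn pa na pb nb ∧ pa ≡ᵇ b)) ∨ (pa ∧ na)) ∨ ((m ∧ (forcedIn pb nb pa na ∧ pb ≡ᵇ b)) ∨ (pb ∧ nb)) ≡
               (pa ∨ pb) ∧ (na ∨ nb)
  mixed-gate m pa na pb nb b ha hb = ≡ᵇ⇒≡ (⇒ᵇ-mp (⇒ᵇ-mp (valid-sound 6
    (λ m pa na pb nb b → (pa ∨ na ⇒ᵇ m) ⇒ᵇ (pb ∨ nb ⇒ᵇ m) ⇒ᵇ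
       (((m ∧ (forcedIn pa na pb nb ∧ pa ≡ᵇ b)) ∨ (pa ∧ na)) ∨ ((m ∧ (forcedIn pb nb pa na ∧ pb ≡ᵇ b)) ∨ (pb ∧ nb))) ≡ᵇ
       ((pa ∨ pb) ∧ (na ∨ nb)))
    refl m pa na pb nb b) ha) hb)

  mixed-plus : ∀ m pa na pb nb → (pa ∨ na ⇒ᵇ m) ≡ true → (pb ∨ nb ⇒ᵇ m) ≡ true → pa ∨ na ≡ pb ∨ nb →
               (m ∧ forcedIn pa na pb nb) ∨ (pa ∧ na) ≡ (m ∧ forcedIn pb nb pa na) ∨ (pb ∧ nb)
  mixed-plus m pa na pb nb ha hb h = ≡ᵇ⇒≡ (⇒ᵇ-mp (⇒ᵇ-mp (⇒ᵇ-mp (valid-sound 5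
    (λ m pa na pb nb → (pa ∨ na ⇒ᵇ m) ⇒ᵇ (pb ∨ nb ⇒ᵇ m) ⇒ᵇ (pa ∨ na) ≡ᵇ (pb ∨ nb) ⇒ᵇ
       ((m ∧ forcedIn pa na pb nb) ∨ (pa ∧ na)) ≡ᵇ ((m ∧ forcedIn pb nb pa na) ∨ (pb ∧ nb)))
    refl m pa na pb nb) ha) hb) (≡⇒≡ᵇ h))

  mixed-times : ∀ m pa na pb nb → ((pa ∨ na) ∧ (pb ∨ nb) ⇒ᵇ not ((pa ∨ pb) ∧ (na ∨ nb))) ≡ true →
                ((m ∧ forcedIn pa na pb nb) ∨ (pa ∧ na)) ∧ ((m ∧ forcedIn pb nb pa na) ∨ (pb ∧ nb)) ≡ false
  mixed-times m pa na pb nb h = BP.not-injective (⇒ᵇ-mp (valid-sound 5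
    (λ m pa na pb nb → ((pa ∨ na) ∧ (pb ∨ nb) ⇒ᵇ not ((pa ∨ pb) ∧ (na ∨ nb))) ⇒ᵇ
       not (((m ∧ forcedIn pa na pb nb) ∨ (pa ∧ na)) ∧ ((m ∧ forcedIn pb nb pa na) ∨ (pb ∧ nb))))
    refl m pa na pb nb) h)

  forced⇒unmixed : ∀ p n q → (p xor n) ∧ q ≡ true → p ∧ n ≡ false
  forced⇒unmixed true  true  q ()
  forced⇒unmixed true  false q _ = refl
  forced⇒unmixed false n     q _ = refl

  ⇒ᵇ-not-intro : ∀ {p q r s} → (p ≡ true → q ≡ true → r ≡ true → s ≡ true → ⊥) → (p ∧ q ⇒ᵇ not (r ∧ s)) ≡ true
  ⇒ᵇ-not-intro {false}                      h = refl
  ⇒ᵇ-not-intro {true} {false}               h = refl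
  ⇒ᵇ-not-intro {true} {true} {false}        h = refl
  ⇒ᵇ-not-intro {true} {true} {true} {false} h = refl
  ⇒ᵇ-not-intro {true} {true} {true} {true}  h = ⊥-elim (h refl refl refl refl)

  -- every literal below a node is forced there, so it can be replaced by 1 and reintroduced higher up
  unitLiterals : ∀ {v} → Label v → Label v
  unitLiterals (const r) = const r
  unitLiterals (lit _ _) = const 1#

  module Pruning {v} (Vs : List (Fin v)) where

    forcedˡ forcedʳ : ∀ {k} → Circ v k → Op → Fin k → Fin k → List (Gadget v)
    forcedˡ T _ a b = gadgetsFor (λ y → forcedIn (occurs T a y true) (occurs T a y false) (occurs T b y true) (occurs T b y false))
                                 (λ y → literal (occurs T a y true)) Vs
    forcedʳ T _ a b = gadgetsFor (λ y → forcedIn (occurs T b y true) (occurs T b y false) (occurs T a y true) (occurs T a y false))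
                                 (λ y → literal (occurs T b y true)) Vs

    open Rebuild unitLiterals forcedˡ forcedʳ public

    agreesAt : ∀ {k} → Circ v k → Fin k → Assignment v → Fin v → Bool
    agreesAt T i α y = agrees (occurs T i y true) (occurs T i y false) (α y)

    forcedHolds : ∀ {k} → Circ v k → Fin k → Fin k → Assignment v → Fin v → Bool
    forcedHolds T a b α y =
      forcedIn (occurs T a y true) (occurs T a y false) (occurs T b y true) (occurs T b y false) ⇒ᵇ occurs T a y true ≡ᵇ α y

    Hypotheses : ∀ {k} → Circ v k → Set c
    Hypotheses T = Covers Vs T × Smoothᵇ T × WeaklyDecomposableᵇ T

    Hypotheses-tail : ∀ {k} {nd : Node v k} {T : Circ v k} → Hypotheses (nd ∷ T) → Hypotheses T
    Hypotheses-tail (cover , smooth , wd) = (λ i → cover (suc i)) , Smoothᵇ-tail smooth , WeaklyDecomposableᵇ-tail wd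

    covered : ∀ {k o a b} {T : Circ v k} → Covers Vs (gate o a b ∷ T) → ∀ j x → (hasVar T j x ⇒ᵇ x ∈ᵇ Vs) ≡ true
    covered {T = T} cover j x = ⇒ᵇ-intro (Covers-hasVar {Vs = Vs} T (λ i → cover (suc i)) j x)

    pruning-occurs : ∀ {k} (T : Circ v k) → Hypotheses T → ∀ i x b →
                     occurs (out (rebuild T)) (image (rebuild T) i) x b ≡ occurs T i x true ∧ occurs T i x false
    pruning-occurs (nd ∷ T) H (suc i) x b rewrite block-image T (rebuild T) nd i =
      trans (block-occurs T (rebuild T) nd _ x b) (pruning-occurs T (Hypotheses-tail H) i x b)
    pruning-occurs (leaf (const _) ∷ T) H zero x b = refl
    pruning-occurs (leaf (lit y p) ∷ T) H zero x b = sym (unmixed (y ≡ᶠ x) p)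
      where
      unmixed : ∀ e p → (e ∧ p ≡ᵇ true) ∧ (e ∧ p ≡ᵇ false) ≡ false
      unmixed true  true  = refl
      unmixed true  false = refl
      unmixed false p     = refl
    pruning-occurs (gate o a b ∷ T) H@(cover , _ , _) zero x p =
      trans (Gate.occurs-top T o a b (rebuild T) x p)
            (trans (cong₂ _∨_ (cong₂ _∨_ (gadgetsFor-occurs _ _ Vs x p) (pruning-occurs T (Hypotheses-tail H) a x p))
                              (cong₂ _∨_ (gadgetsFor-occurs _ _ Vs x p) (pruning-occurs T (Hypotheses-tail H) b x p)))
                   (mixed-gate (x ∈ᵇ Vs) (occurs T a x true) (occurs T a x false) (occurs T b x true) (occurs T b x false) p
                               (covered cover a x) (covered cover b x)))

    pruning-hasVar : ∀ {k} (T : Circ v k) → Hypotheses T → ∀ i x →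
                     hasVar (out (rebuild T)) (image (rebuild T) i) x ≡ occurs T i x true ∧ occurs T i x false
    pruning-hasVar T H i x = trans (cong₂ _∨_ (pruning-occurs T H i x true) (pruning-occurs T H i x false)) (BP.∨-idem _)

    pruning-fresh : ∀ {k} (T : Circ v k) → Hypotheses T → ∀ a y q →
                    (occurs T a y true xor occurs T a y false) ∧ q ≡ true → hasVar (out (rebuild T)) (image (rebuild T) a) y ≡ false
    pruning-fresh T H a y q h = trans (pruning-hasVar T H a y) (forced⇒unmixed (occurs T a y true) (occurs T a y false) q h)

    pruning-value : ∀ {k} (T : Circ v k) → Hypotheses T → ∀ i α →
                    lookup (values T α) i ≈ toF (allᵇ (agreesAt T i α) Vs) * lookup (values (out (rebuild T)) α) (image (rebuild T) i)
    pruning-value (nd ∷ T) H (suc i) α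
      rewrite block-image T (rebuild T) nd i | block-value T (rebuild T) nd (image (rebuild T) i) α =
      pruning-value T (Hypotheses-tail H) i α
    pruning-value (leaf (const r) ∷ T) H zero α =
      R.trans (R.sym (R.*-identityˡ r)) (R.*-cong (R.reflexive (cong toF (sym (allᵇ-true Vs)))) R.refl)
    pruning-value (leaf (lit y p) ∷ T) (cover , _) zero α =
      R.trans (literal-value α y p) (R.trans (R.sym (R.*-identityʳ _)) (R.*-cong (R.reflexive (cong toF (sym only-y))) R.refl))
      where
      others : ∀ z → z ≡ᶠ y ≡ false → agreesAt (leaf (lit y p) ∷ T) zero α z ≡ true
      others z z≢y rewrite ≡ᶠ-sym y z | z≢y = refl
      at-y : agreesAt (leaf (lit y p) ∷ T) zero α y ≡ p ≡ᵇ α y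
      at-y rewrite ≡ᶠ-refl y = agrees-literal p (α y)
        where
        agrees-literal : ∀ p b → agrees (p ≡ᵇ true) (p ≡ᵇ false) b ≡ p ≡ᵇ b
        agrees-literal true  b = refl
        agrees-literal false b = refl
      y∈Vs : y ∈ᵇ Vs ≡ true
      y∈Vs = cover zero y p (trans (cong (_∧ p ≡ᵇ p) (≡ᶠ-refl y)) (≡⇒≡ᵇ {p} refl))
      only-y : allᵇ (agreesAt (leaf (lit y p) ∷ T) zero α) Vs ≡ p ≡ᵇ α y
      only-y = trans (allᵇ-∈ _ y others Vs y∈Vs) at-y
    pruning-value (gate plus a b ∷ T) H@(_ , smooth , _) zero α = begin
      lookup (values T α) a + lookup (values T α) b
        ≈⟨ R.+-cong (pruning-value T (Hypotheses-tail H) a α) (pruning-value T (Hypotheses-tail H) b α) ⟩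
      toF (allᵇ (agreesAt T a α) Vs) * va + toF (allᵇ (agreesAt T b α) Vs) * vb
        ≡⟨ cong₂ (λ A B → toF A * va + toF B * vb)
             (allᵇ-split (λ y → agrees-plusˡ (pa y) (na y) (pb y) (nb y) (α y) (smooth zero refl y)) Vs)
             (allᵇ-split (λ y → agrees-plusʳ (pa y) (na y) (pb y) (nb y) (α y) (smooth zero refl y)) Vs) ⟩
      toF (atGate ∧ holdsˡ) * va + toF (atGate ∧ holdsʳ) * vb
        ≈⟨ common-factor-+ atGate holdsˡ holdsʳ va vb ⟩
      toF atGate * (toF holdsˡ * va + toF holdsʳ * vb)
        ≈⟨ R.*-cong R.refl (R.+-cong (R.trans (R.*-cong (R.sym (product-literals α _ _ Vs)) R.refl) (R.sym (value-lhs α)))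
                                     (R.trans (R.*-cong (R.sym (product-literals α _ _ Vs)) R.refl) (R.sym (value-rhs α)))) ⟩
      toF atGate * lookup (values (out (rebuild (gate plus a b ∷ T))) α) zero ∎
      where
      open SetoidReasoning R.setoid
      open Gate T plus a b (rebuild T)
      pa na pb nb : Fin v → Bool
      pa y = occurs T a y true
      na y = occurs T a y false
      pb y = occurs T b y true
      nb y = occurs T b y false
      va vb : Carrier
      va = lookup (values (out (rebuild T)) α) (image (rebuild T) a)
      vb = lookup (values (out (rebuild T)) α) (image (rebuild T) b)
      atGate holdsˡ holdsʳ : Bool
      atGate = allᵇ (agreesAt (gate plus a b ∷ T) zero α) Vs
      holdsˡ = allᵇ (forcedHolds T a b α) Vs
      holdsʳ = allᵇ (forcedHolds T b a α) Vs
    pruning-value (gate times a b ∷ T) H@(_ , _ , wd) zero α = begin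
      lookup (values T α) a * lookup (values T α) b
        ≈⟨ R.*-cong (pruning-value T (Hypotheses-tail H) a α) (pruning-value T (Hypotheses-tail H) b α) ⟩
      (toF (allᵇ (agreesAt T a α) Vs) * va) * (toF (allᵇ (agreesAt T b α) Vs) * vb)
        ≈⟨ common-factor-* (allᵇ (agreesAt T a α) Vs) (allᵇ (agreesAt T b α) Vs) atGate holdsˡ holdsʳ va vb agreement ⟩
      toF atGate * ((toF holdsˡ * va) * (toF holdsʳ * vb))
        ≈⟨ R.*-cong R.refl (R.*-cong (R.trans (R.*-cong (R.sym (product-literals α _ _ Vs)) R.refl) (R.sym (value-lhs α)))
                                     (R.trans (R.*-cong (R.sym (product-literals α _ _ Vs)) R.refl) (R.sym (value-rhs α)))) ⟩
      toF atGate * lookup (values (out (rebuild (gate times a b ∷ T))) α) zero ∎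
      where
      open SetoidReasoning R.setoid
      open Gate T times a b (rebuild T)
      va vb : Carrier
      va = lookup (values (out (rebuild T)) α) (image (rebuild T) a)
      vb = lookup (values (out (rebuild T)) α) (image (rebuild T) b)
      atGate holdsˡ holdsʳ : Bool
      atGate = allᵇ (agreesAt (gate times a b ∷ T) zero α) Vs
      holdsˡ = allᵇ (forcedHolds T a b α) Vs
      holdsʳ = allᵇ (forcedHolds T b a α) Vs
      agreement : allᵇ (agreesAt T a α) Vs ∧ allᵇ (agreesAt T b α) Vs ≡ atGate ∧ (holdsˡ ∧ holdsʳ)
      agreement = trans (allᵇ-∧ (agreesAt T a α) (agreesAt T b α) Vs)
                 (trans (allᵇ-split (λ y → agrees-times (occurs T a y true) (occurs T a y false) (occurs T b y true) (occurs T b y false)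
                                                             (α y) (⇒ᵇ-not-intro (wd zero refl y))) Vs)
                        (cong (atGate ∧_) (sym (allᵇ-∧ (forcedHolds T a b α) (forcedHolds T b a α) Vs))))

    pruning-SD : ∀ {k} (T : Circ v k) → Distinct Vs → Hypotheses T → SD (out (rebuild T))
    pruning-SD [] _ _ = tt
    pruning-SD (leaf _ ∷ T) distinct H = tt , pruning-SD T distinct (Hypotheses-tail H)
    pruning-SD {suc k} (gate o a b ∷ T) distinct H@(cover , smooth , wd) =
      SD-top (pruning-SD T distinct H′) okˡ okʳ (top-SD o refl)
      where
      r : Rebuilt k
      r = rebuild T
      H′ : Hypotheses T
      H′ = Hypotheses-tail H
      open Gate T o a b r
      okˡ : Attachable (forcedˡ T o a b) (out r) (image r a)
      okˡ = gadgetsFor-attachable _ _ Vs _ _ distinct λ y h → pruning-fresh T H′ a y _ h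
      okʳ : Attachable (forcedʳ T o a b) (circ lhs) (embed (ext lhs) (image r b))
      okʳ = gadgetsFor-attachable _ _ Vs _ _ distinct λ y h → trans (hasVar-embed (ext lhs) (image r b) y) (pruning-fresh T H′ b y _ h)
      vars-lhs : ∀ x → hasVar (circ rhs) (embed (ext rhs) (root lhs)) x ≡
                 (x ∈ᵇ Vs ∧ forcedIn (occurs T a x true) (occurs T a x false) (occurs T b x true) (occurs T b x false)) ∨
                 (occurs T a x true ∧ occurs T a x false)
      vars-lhs x = trans (hasVar-lhs x) (cong₂ _∨_ (gadgetsFor-hasVar _ _ Vs x) (pruning-hasVar T H′ a x))
      vars-rhs : ∀ x → hasVar (circ rhs) (root rhs) x ≡
                 (x ∈ᵇ Vs ∧ forcedIn (occurs T b x true) (occurs T b x false) (occurs T a x true) (occurs T a x false)) ∨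
                 (occurs T b x true ∧ occurs T b x false)
      vars-rhs x = trans (hasVar-rhs x) (cong₂ _∨_ (gadgetsFor-hasVar _ _ Vs x) (pruning-hasVar T H′ b x))
      top-SD : ∀ o′ → o ≡ o′ → SDNode top (circ rhs)
      top-SD plus refl x = trans (vars-lhs x) (trans
        (mixed-plus (x ∈ᵇ Vs) (occurs T a x true) (occurs T a x false) (occurs T b x true) (occurs T b x false)
                    (covered cover a x) (covered cover b x) (smooth zero refl x))
        (sym (vars-rhs x)))
      top-SD times refl x h₁ h₂ = true≢false (cong₂ _∧_ (trans (sym (vars-lhs x)) h₁) (trans (sym (vars-rhs x)) h₂))
        (mixed-times (x ∈ᵇ Vs) (occurs T a x true) (occurs T a x false) (occurs T b x true) (occurs T b x false)
                     (⇒ᵇ-not-intro (wd zero refl x)))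

  -- The simulations

  varsOf : ∀ {v k} → Circ v k → List (Fin v)
  varsOf C = dedup (literalVars C)

  varsOf-covers : ∀ {v k} (C : Circ v k) → Covers (varsOf C) C
  varsOf-covers C i x b h = trans (∈ᵇ-dedup x (literalVars C)) (literalVars-covers C i x b h)

  varsOf-length : ∀ {v k} (C : Circ v k) → 4 ℕ.* length (varsOf C) ℕ.≤ 4 ℕ.* k
  varsOf-length C = ℕP.*-monoʳ-≤ 4 (ℕP.≤-trans (length-dedup-≤ (literalVars C)) (literalVars-length C))

  linear-bound : ∀ s → s ℕ.≤ 1 ℕ.* s ^ 1 ℕ.+ 1
  linear-bound s rewrite ℕP.*-identityˡ (s ^ 1) | ℕP.*-identityʳ s = ℕP.m≤m+n s 1

  D≼sD : D-ACp ≼ sD-ACp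
  D≼sD = 1 , 1 , λ v C (ss , _ , dec , pos) → C , (ss , dec , pos) , (λ _ → R.refl) , linear-bound (size C)

  swD≼sD : swD-ACp ≼ sD-ACp
  swD≼sD = 1 , 1 , λ v C (ss , sm , dec , pos) →
    C , (ss , sm , (λ i j₁ j₂ e x in₁ in₂ _ → dec i j₁ j₂ e x (in₁ , in₂)) , pos) ,
    (λ _ → R.refl) , linear-bound (size C)

  module Smoothed {v k} (C : Circ v (suc k)) (ss : SingleSource (k , C)) (dec : Decomposable (k , C)) (pos : Positive (k , C)) where
    open Smoothing (varsOf C)

    E : Extension (out (rebuild C))
    E = finish [] C

    smoothed : AC v
    smoothed = toAC (circ E) (root E)

    smoothed-value : ∀ α → ⟦ smoothed ⟧ α ≈ ⟦ k , C ⟧ α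
    smoothed-value α = R.trans (R.reflexive (toAC-value (circ E) (root E) (finish-isZero [] C) α)) (smoothing-value C zero α)

    smoothed-sD : sD-ACp smoothed
    smoothed-sD = toAC-singleSource (circ E) (root E) (finish-isZero [] C) (finish-singleSource [] C ss) ,
                  toAC-smooth (circ E) (root E) sd , toAC-decomposable (circ E) (root E) sd ,
                  Positive-resp-≈ smoothed (k , C) smoothed-value pos
      where
      sd : SD (circ E)
      sd = smoothing-SD C (dedup-distinct (literalVars C)) (varsOf-covers C) (Decomposable⇒Decomposableᵇ C dec)

    smoothed-size : size smoothed ℕ.≤ 13 ℕ.* suc k ^ 2 ℕ.+ 13
    smoothed-size rewrite toAC-size (circ E) (root E) =
      quadratic-bound k N _ (varsOf-length C) (ℕP.≤-trans (rebuild-len N padˡ≤ padʳ≤ C) (ℕP.m≤n+m _ N))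
      where
      N : ℕ
      N = 4 ℕ.* length (varsOf C)
      padˡ≤ : ∀ {k} (T : Circ v k) o a b → gadgetsSize (padˡ T o a b) ℕ.≤ N
      padˡ≤ T plus  a b = gadgetsFor-size _ _ (varsOf C)
      padˡ≤ T times a b = z≤n
      padʳ≤ : ∀ {k} (T : Circ v k) o a b → gadgetsSize (padʳ T o a b) ℕ.≤ N
      padʳ≤ T plus  a b = gadgetsFor-size _ _ (varsOf C)
      padʳ≤ T times a b = z≤n

  sD≼D : sD-ACp ≼ D-ACp
  sD≼D = 13 , 2 , λ v (k , C) (ss , dec , pos) → let open Smoothed C ss dec pos in
    smoothed , smoothed-sD , smoothed-value , smoothed-size

  module Pruned {v k} (C : Circ v (suc k)) (ss : SingleSource (k , C)) (sm : Smooth (k , C))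
                (wd : WeaklyDecomposable (k , C)) (pos : Positive (k , C)) where
    open Pruning (varsOf C)

    H : Hypotheses C
    H = varsOf-covers C , Smooth⇒Smoothᵇ C sm , WeaklyDecomposable⇒WeaklyDecomposableᵇ C wd

    G₀ : List (Gadget v)
    G₀ = gadgetsFor (λ y → occurs C zero y true xor occurs C zero y false) (λ y → literal (occurs C zero y true)) (varsOf C)

    E : Extension (out (rebuild C))
    E = finish G₀ C

    pruned : AC v
    pruned = toAC (circ E) (root E)

    pruned-value : ∀ α → ⟦ pruned ⟧ α ≈ ⟦ k , C ⟧ α
    pruned-value α = begin
      ⟦ pruned ⟧ α
        ≡⟨ toAC-value (circ E) (root E) (finish-isZero G₀ C) α ⟩
      lookup (values (circ E) α) (root E)
        ≈⟨ attachAll-value G₀ _ _ α ⟩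
      gadgetsProduct α G₀ * lookup (values (out (rebuild C)) α) (image (rebuild C) zero)
        ≈⟨ R.*-cong (product-literals α _ _ (varsOf C)) R.refl ⟩
      toF (allᵇ (agreesAt C zero α) (varsOf C)) * lookup (values (out (rebuild C)) α) (image (rebuild C) zero)
        ≈⟨ pruning-value C H zero α ⟨
      ⟦ k , C ⟧ α ∎
      where open SetoidReasoning R.setoid

    pruned-sD : sD-ACp pruned
    pruned-sD = toAC-singleSource (circ E) (root E) (finish-isZero G₀ C) (finish-singleSource G₀ C ss) ,
                toAC-smooth (circ E) (root E) sd , toAC-decomposable (circ E) (root E) sd ,
                Positive-resp-≈ pruned (k , C) pruned-value pos
      where
      fresh : Attachable G₀ (out (rebuild C)) (image (rebuild C) zero)
      fresh = gadgetsFor-attachable _ _ (varsOf C) _ _ (dedup-distinct (literalVars C))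
                λ y h → pruning-fresh C H zero y true (trans (BP.∧-identityʳ _) h)
      sd : SD (circ E)
      sd = attachAll-SD _ _ G₀ (pruning-SD C (dedup-distinct (literalVars C)) H) fresh

    pruned-size : size pruned ℕ.≤ 13 ℕ.* suc k ^ 2 ℕ.+ 13
    pruned-size rewrite toAC-size (circ E) (root E) | attachAll-width (out (rebuild C)) (image (rebuild C) zero) G₀ =
      quadratic-bound k N _ (varsOf-length C)
        (ℕP.+-mono-≤ (gadgetsFor-size _ _ (varsOf C)) (rebuild-len N (λ T o a b → gadgetsFor-size _ _ (varsOf C))
                                                                      (λ T o a b → gadgetsFor-size _ _ (varsOf C)) C))
      where
      N : ℕ
      N = 4 ℕ.* length (varsOf C)

  sD≼swD : sD-ACp ≼ swD-ACp
  sD≼swD = 13 , 2 , λ v (k , C) (ss , sm , wd , pos) → let open Pruned C ss sm wd pos in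
    pruned , pruned-sD , pruned-value , pruned-size

lemma12 : ∀ {c ℓ₁ ℓ₂ : Level} (F : OrderedField c ℓ₁ ℓ₂) →
    let open Circuits F in
    (D-ACp ≃ sD-ACp) × (sD-ACp ≃ swD-ACp)
lemma12 F = (D≼sD , sD≼D) , (sD≼swD , swD≼sD)
  where open Constructions F
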